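{- Let $p$ be a prime with $p\equiv 15$ or $27\pmod{28}$. For all integers $n,k\geq 0$ with $p\nmid n$, \[ c_{13,1}\left(8p^{2k+1}n+\frac{26p^{2k+2}+9}{7}\right)\equiv 0\pmod 2. \]
   Context: For complex $a,b$ the false theta function is $\Psi(a,b):=\sum_{n=0}^\infty a^{n(n+1)/2}b^{n(n-1)/2}-\sum_{n=-\infty}^{ -1}a^{n(n+1)/2}b^{n(n-1)/2}$. For positive integers $r,s$, the integers $c_{r,s}(n)$ ($n\ge 0$) are defined by the power series identity $\sum_{n=0}^\infty c_{r,s}(n)q^n=\dfrac{1}{\Psi(-q^r,q^s)}$ (the denominator is a power series in $q$ with constant term $1$). -}

module Defs where

open import Data.Nat as ℕ using (ℕ; zero; suc; _≡ᵇ_)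
open import Data.Nat.DivMod using (_/_; _%_)
open import Data.Integer as ℤ using (ℤ; +_; -_)
open import Data.List using (List; []; _∷_; map; upTo; zipWith; foldr)
open import Data.Bool using (if_then_else_)

zsum : List ℤ → ℤ
zsum = foldr ℤ._+_ (+ 0)

tri : ℕ → ℕ
tri n = (n ℕ.* suc n) / 2

sgn : ℕ → ℤ
sgn k = if (k % 2) ≡ᵇ 0 then + 1 else - (+ 1)

at : ℕ → ℕ → ℤ → ℤ
at e N v = if e ≡ᵇ N then v else + 0

-- Coefficient of q^N in Ψ(-q^r, q^s).
-- Term for n ≥ 0:  (-1)^{n(n+1)/2} q^{r n(n+1)/2 + s n(n-1)/2}
-- Term for n = -m, m ≥ 1 (subtracted):
--   (-1)^{m(m-1)/2} q^{r m(m-1)/2 + s m(m+1)/2}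
-- For r,s ≥ 1 all contributing indices satisfy n ≤ N, m ≤ N.
psiCoeff : ℕ → ℕ → ℕ → ℤ
psiCoeff r s N =
  zsum (map (λ n → at (r ℕ.* tri n ℕ.+ s ℕ.* tri (n ℕ.∸ 1)) N (sgn (tri n))) (upTo (suc N)))
  ℤ.- zsum (map (λ i → at (r ℕ.* tri i ℕ.+ s ℕ.* tri (suc i)) N (sgn (tri i))) (upTo N))
  -- second sum: m = suc i ranges over 1..N, and m(m-1)/2 = tri i, m(m+1)/2 = tri (suc i)

-- reversed list [c(N), c(N-1), ..., c(0)] of coefficients of 1/Ψ(-q^r,q^s)
cStep : ℕ → ℕ → ℕ → List ℤ → List ℤ
-- given L = [c(N), ..., c(0)], prepend c(N+1) = - Σ_{j=1}^{N+1} psiCoeff(j) c(N+1-j)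
-- (L[j-1] = c(N+1-j))
cStep r s N L = - zsum (zipWith ℤ._*_ (map (λ i → psiCoeff r s (suc i)) (upTo (suc N))) L) ∷ L

cRev : ℕ → ℕ → ℕ → List ℤ
cRev r s zero = + 1 ∷ []
cRev r s (suc N) = cStep r s N (cRev r s N)

headOr0 : List ℤ → ℤ
headOr0 [] = + 0
headOr0 (x ∷ _) = x

c : ℕ → ℕ → ℕ → ℤ
c r s N = headOr0 (cRev r s N)

{-# OPTIONS --safe #-}
module Submission where

-- Modulo 2 the signs of Ψ(-q¹³, q) disappear and it becomes A(q) = Σ_{z ∈ ℤ} q^(7z² + 6z), so the
-- c₁₃,₁(n) reduce to the coefficients of C = 1/A over F₂. Squaring is q ↦ q² in characteristic 2,
-- hence C = A⁷ · C(q⁸) with A⁷ = A(q) A(q²) A(q⁴), and reading off the coefficients of q^(8m+5)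
-- gives c(8m + 5) = (C · A · R)(m) = R(m) as soon as [q^(8j+5)] A⁷ = [q^j] (A · R). That identity is
-- an injective linear change of variables L : ℤ³ → ℤ³ matching the solutions of
-- e(a) + 2e(b) + 4e(c) = 8j + 5, where e(z) = 7z² + 6z, with those of
-- 28e(d) + (14s + 3)² + (14t + 2)² = 28j + 13; here R(j) counts the (s, t) with
-- (14s + 3)² + (14t + 2)² = 28j + 13. For the index N = 8M + 5 of the theorem,
-- 28M + 13 = p^(2k+1) (28n + 13p) with p ∤ 28n + 13p, and as p ≡ 3 (mod 4) no such number is a sum
-- of two squares, so R(M) = 0.

module XorSums where
  open import Algebra.Bundles using (CommutativeRing; CommutativeSemigroup)
  import Algebra.Properties.CommutativeSemigroup as CommSemigroupProperties
  open import Data.Bool using (Bool; true; false; _∧_; _xor_)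
  open import Data.Bool.Properties
    using (∧-conicalʳ; ∧-distribʳ-xor; xor-assoc; xor-identityʳ; xor-∧-commutativeRing)
  open import Data.List using (List; []; _∷_; _++_; map; cartesianProduct)
  open import Data.List.Membership.Propositional using (_∈_)
  open import Data.List.Relation.Unary.Any using (here; there)
  open import Data.List.Relation.Unary.All as All using ()
  open import Data.List.Relation.Unary.Unique.Propositional using (Unique; _∷_)
  open import Data.Product using (_×_; _,_)
  open import Function using (_∘_)
  open import Level using (0ℓ)
  open import Relation.Binary.Definitions using (DecidableEquality)
  open import Relation.Binary.PropositionalEquality
  open import Relation.Nullary using (yes; no; does)
  open import Relation.Nullary.Decidable using (dec-true; dec-false)

  xor-commutativeSemigroup : CommutativeSemigroup 0ℓ 0ℓ
  xor-commutativeSemigroup = record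
    { _∙_                    = _xor_
    ; isCommutativeSemigroup = CommutativeRing.+-isCommutativeSemigroup xor-∧-commutativeRing
    }

  module Xor = CommSemigroupProperties xor-commutativeSemigroup

  private
    variable
      A B : Set
      xs ys : List A
      f g : A → Bool

  -- Opaque, so that unification never unfolds ∑ over a concrete list such as upTo (suc n),
  -- which would leave its summand as an unsolvable meta.
  opaque
    ∑ : List A → (A → Bool) → Bool
    ∑ []       f = false
    ∑ (x ∷ xs) f = f x xor ∑ xs f

  opaque
    unfolding ∑

    ∑-[] : ∑ [] f ≡ false
    ∑-[] = refl

    ∑-∷ : ∀ x xs → ∑ (x ∷ xs) f ≡ f x xor ∑ xs f
    ∑-∷ x xs = refl

    ∑-cong : (∀ {x} → x ∈ xs → f x ≡ g x) → ∑ xs f ≡ ∑ xs g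
    ∑-cong {xs = []}     eq = refl
    ∑-cong {xs = x ∷ xs} eq = cong₂ _xor_ (eq (here refl)) (∑-cong (eq ∘ there))

    ∑-zero : (∀ {x} → x ∈ xs → f x ≡ false) → ∑ xs f ≡ false
    ∑-zero {xs = []}     eq = refl
    ∑-zero {xs = x ∷ xs} eq = cong₂ _xor_ (eq (here refl)) (∑-zero (eq ∘ there))

    ∑-xor : ∀ xs → ∑ xs (λ x → f x xor g x) ≡ ∑ xs f xor ∑ xs g
    ∑-xor []                   = refl
    ∑-xor {f = f} {g} (x ∷ xs) =
      trans (cong ((f x xor g x) xor_) (∑-xor xs)) (Xor.interchange (f x) (g x) (∑ xs f) (∑ xs g))

    ∑-∧ : ∀ b xs → ∑ xs f ∧ b ≡ ∑ xs (λ x → f x ∧ b)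
    ∑-∧ b []                 = refl
    ∑-∧ {f = f} b (x ∷ xs) = trans (∧-distribʳ-xor b (f x) (∑ xs f)) (cong (f x ∧ b xor_) (∑-∧ b xs))

    ∑-comm : ∀ xs ys (F : A → B → Bool) → ∑ xs (λ x → ∑ ys (F x)) ≡ ∑ ys (λ y → ∑ xs (λ x → F x y))
    ∑-comm []       ys F = sym (∑-zero {xs = ys} (λ _ → refl))
    ∑-comm (x ∷ xs) ys F = trans (cong (∑ ys (F x) xor_) (∑-comm xs ys F)) (sym (∑-xor ys))

    ∑-++ : ∀ xs → ∑ (xs ++ ys) f ≡ ∑ xs f xor ∑ ys f
    ∑-++ []                          = refl
    ∑-++ {ys = ys} {f = f} (x ∷ xs) = trans (cong (f x xor_) (∑-++ xs)) (sym (xor-assoc (f x) (∑ xs f) (∑ ys f)))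

    ∑-map : ∀ (k : B → A) xs → ∑ (map k xs) f ≡ ∑ xs (f ∘ k)
    ∑-map k []       = refl
    ∑-map {f = f} k (x ∷ xs) = cong (f (k x) xor_) (∑-map k xs)

    ∑-cartesianProduct : ∀ xs (ys : List B) (f : A × B → Bool) →
                         ∑ (cartesianProduct xs ys) f ≡ ∑ xs (λ x → ∑ ys (λ y → f (x , y)))
    ∑-cartesianProduct []       ys f = refl
    ∑-cartesianProduct (x ∷ xs) ys f = begin
      ∑ (map (x ,_) ys ++ cartesianProduct xs ys) f                 ≡⟨ ∑-++ (map (x ,_) ys) ⟩
      ∑ (map (x ,_) ys) f xor ∑ (cartesianProduct xs ys) f          ≡⟨ cong₂ _xor_ (∑-map (x ,_) ys) (∑-cartesianProduct xs ys f) ⟩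
      ∑ ys (λ y → f (x , y)) xor ∑ xs (λ x → ∑ ys (λ y → f (x , y))) ∎
      where open ≡-Reasoning

    ∑-single : ∀ {t} → Unique xs → t ∈ xs → (∀ {x} → x ∈ xs → x ≢ t → f x ≡ false) → ∑ xs f ≡ f t
    ∑-single {f = f} (x∉xs ∷ _) (here refl) off =
      trans (cong (f _ xor_) (∑-zero (λ y∈xs → off (there y∈xs) (≢-sym (All.lookup x∉xs y∈xs)))))
            (xor-identityʳ (f _))
    ∑-single {xs = x ∷ xs} {f = f} (x∉xs ∷ uniq) (there t∈xs) off =
      trans (cong (_xor ∑ xs f) (off (here refl) (All.lookup x∉xs t∈xs))) (∑-single uniq t∈xs (off ∘ there))

  ∑-at : ∀ {A : Set} {xs : List A} {f : A → Bool} {t} → DecidableEquality A → Unique xs →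
         (f t ≡ true → t ∈ xs) → (∀ {x} → x ∈ xs → x ≢ t → f x ≡ false) → ∑ xs f ≡ f t
  ∑-at {xs = xs} {f} {t} _≟_ uniq covers off with f t in ft
  ... | true  = trans (∑-single uniq (covers refl) off) ft
  ... | false = ∑-zero vanish
    where
    vanish : ∀ {x} → x ∈ xs → f x ≡ false
    vanish {x} x∈xs with x ≟ t
    ... | yes refl = ft
    ... | no  x≢t  = off x∈xs x≢t

  ∑-cover : ∀ {A : Set} {xs ys : List A} {f : A → Bool} → DecidableEquality A → Unique xs → Unique ys →
            (∀ {x} → f x ≡ true → x ∈ xs) → (∀ {x} → f x ≡ true → x ∈ ys) → ∑ xs f ≡ ∑ ys f
  ∑-cover {xs = xs} {ys} {f} _≟_ uniqˣ uniqʸ inˣ inʸ = begin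
    ∑ xs f                                        ≡⟨ ∑-cong {xs = xs} (λ {x} _ → sym (collapse {x})) ⟩
    ∑ xs (λ x → ∑ ys (λ y → does (x ≟ y) ∧ f x))  ≡⟨ ∑-comm xs ys _ ⟩
    ∑ ys (λ y → ∑ xs (λ x → does (x ≟ y) ∧ f x))  ≡⟨ ∑-cong {xs = ys} (λ {y} _ → diagonal {y}) ⟩
    ∑ ys f                                        ∎
    where
    open ≡-Reasoning
    collapse : ∀ {x} → ∑ ys (λ y → does (x ≟ y) ∧ f x) ≡ f x
    collapse {x} = trans (∑-at _≟_ uniqʸ (inʸ ∘ ∧-conicalʳ (does (x ≟ x)) (f x)) off)
                         (cong (_∧ f x) (dec-true (x ≟ x) refl))
      where
      off : ∀ {y} → _ → y ≢ x → does (x ≟ y) ∧ f x ≡ false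
      off {y} _ y≢x = cong (_∧ f x) (dec-false (x ≟ y) (≢-sym y≢x))
    diagonal : ∀ {y} → ∑ xs (λ x → does (x ≟ y) ∧ f x) ≡ f y
    diagonal {y} = trans (∑-at _≟_ uniqˣ (inˣ ∘ ∧-conicalʳ (does (y ≟ y)) (f y)) off)
                         (cong (_∧ f y) (dec-true (y ≟ y) refl))
      where
      off : ∀ {x} → _ → x ≢ y → does (x ≟ y) ∧ f x ≡ false
      off {x} _ x≢y = cong (_∧ f x) (dec-false (x ≟ y) x≢y)

open XorSums

module PowerSeries where
  open import Algebra.Bundles using (CommutativeMonoid)
  import Algebra.Solver.CommutativeMonoid as CMSolver
  open import Data.Bool using (Bool; true; false; _∧_; _xor_)
  open import Data.Bool.Properties
    using (∧-assoc; ∧-comm; ∧-idem; ∧-distribˡ-xor; ∧-distribʳ-xor; xor-assoc; xor-comm; xor-same; xor-identityʳ)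
  open import Data.Nat using (ℕ; zero; suc; _+_; _*_; _≤_; _<_; z≤n; s≤s)
  open import Data.Nat.Properties using (≤-refl; ≤-trans; m≤n⇒m≤1+n)
  open import Data.Nat.Tactic.RingSolver using (solve-∀)
  open import Data.Product using (_,_)
  open import Function using (_∘_)
  open import Level using (0ℓ)
  open import Relation.Binary.PropositionalEquality
  import Relation.Binary.Reasoning.Setoid as SetoidReasoning

  Series : Set
  Series = ℕ → Bool

  𝟘 𝟙 : Series
  𝟘 _ = false
  𝟙 zero    = true
  𝟙 (suc _) = false

  infixl 6 _⊕_
  infixl 7 _⊛_ _·_

  _⊕_ : Series → Series → Series
  (f ⊕ g) n = f n xor g n

  _·_ : Bool → Series → Series
  (b · f) n = b ∧ f n

  -- The Cauchy product, defined by recursion on the index so that its laws follow by induction.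
  _⊛_ : Series → Series → Series
  (f ⊛ g) zero    = f 0 ∧ g 0
  (f ⊛ g) (suc n) = f 0 ∧ g (suc n) xor ((f ∘ suc) ⊛ g) n

  private
    variable
      f f′ g g′ : Series

  infix 4 _≗[≤_]_
  _≗[≤_]_ : Series → ℕ → Series → Set
  f ≗[≤ n ] g = ∀ {i} → i ≤ n → f i ≡ g i

  ⊛-cong-at : ∀ n → f ≗[≤ n ] f′ → g ≗[≤ n ] g′ → (f ⊛ g) n ≡ (f′ ⊛ g′) n
  ⊛-cong-at zero    f≐ g≐ = cong₂ _∧_ (f≐ z≤n) (g≐ z≤n)
  ⊛-cong-at (suc n) f≐ g≐ =
    cong₂ _xor_ (cong₂ _∧_ (f≐ z≤n) (g≐ ≤-refl)) (⊛-cong-at n (f≐ ∘ s≤s) (g≐ ∘ m≤n⇒m≤1+n))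

  ⊛-cong≤ : ∀ {n} → f ≗[≤ n ] f′ → g ≗[≤ n ] g′ → f ⊛ g ≗[≤ n ] f′ ⊛ g′
  ⊛-cong≤ f≐ g≐ {k} k≤n = ⊛-cong-at k (λ i≤k → f≐ (≤-trans i≤k k≤n)) (λ i≤k → g≐ (≤-trans i≤k k≤n))

  ⊛-cong : f ≗ f′ → g ≗ g′ → f ⊛ g ≗ f′ ⊛ g′
  ⊛-cong f≗ g≗ n = ⊛-cong-at n (λ {i} _ → f≗ i) (λ {i} _ → g≗ i)

  ⊛-zeroˡ : ∀ f → 𝟘 ⊛ f ≗ 𝟘
  ⊛-zeroˡ f zero    = refl
  ⊛-zeroˡ f (suc n) = ⊛-zeroˡ f n

  ⊛-identityˡ : ∀ f → 𝟙 ⊛ f ≗ f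
  ⊛-identityˡ f zero    = refl
  ⊛-identityˡ f (suc n) = trans (cong (f (suc n) xor_) (⊛-zeroˡ f n)) (xor-identityʳ (f (suc n)))

  ⊛-distribʳ-⊕ : ∀ f g h → (f ⊕ g) ⊛ h ≗ f ⊛ h ⊕ g ⊛ h
  ⊛-distribʳ-⊕ f g h zero    = ∧-distribʳ-xor (h 0) (f 0) (g 0)
  ⊛-distribʳ-⊕ f g h (suc n) =
    trans (cong₂ _xor_ (∧-distribʳ-xor (h (suc n)) (f 0) (g 0)) (⊛-distribʳ-⊕ (f ∘ suc) (g ∘ suc) h n))
          (Xor.interchange (f 0 ∧ h (suc n)) (g 0 ∧ h (suc n)) (((f ∘ suc) ⊛ h) n) (((g ∘ suc) ⊛ h) n))

  ⊛-·ˡ : ∀ b f g → (b · f) ⊛ g ≗ b · (f ⊛ g)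
  ⊛-·ˡ b f g zero    = ∧-assoc b (f 0) (g 0)
  ⊛-·ˡ b f g (suc n) =
    trans (cong₂ _xor_ (∧-assoc b (f 0) (g (suc n))) (⊛-·ˡ b (f ∘ suc) g n))
          (sym (∧-distribˡ-xor b (f 0 ∧ g (suc n)) (((f ∘ suc) ⊛ g) n)))

  ⊛-assoc : ∀ f g h → (f ⊛ g) ⊛ h ≗ f ⊛ (g ⊛ h)
  ⊛-assoc f g h zero    = ∧-assoc (f 0) (g 0) (h 0)
  ⊛-assoc f g h (suc n) = begin
    (f 0 ∧ g 0) ∧ h (suc n) xor ((f 0 · (g ∘ suc) ⊕ (f ∘ suc) ⊛ g) ⊛ h) n
      ≡⟨ cong ((f 0 ∧ g 0) ∧ h (suc n) xor_) (⊛-distribʳ-⊕ (f 0 · (g ∘ suc)) ((f ∘ suc) ⊛ g) h n) ⟩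
    (f 0 ∧ g 0) ∧ h (suc n) xor (((f 0 · (g ∘ suc)) ⊛ h) n xor (((f ∘ suc) ⊛ g) ⊛ h) n)
      ≡⟨ cong₂ _xor_ (∧-assoc (f 0) (g 0) (h (suc n)))
               (cong₂ _xor_ (⊛-·ˡ (f 0) (g ∘ suc) h n) (⊛-assoc (f ∘ suc) g h n)) ⟩
    f 0 ∧ (g 0 ∧ h (suc n)) xor (f 0 ∧ ((g ∘ suc) ⊛ h) n xor ((f ∘ suc) ⊛ (g ⊛ h)) n)
      ≡⟨ sym (xor-assoc (f 0 ∧ (g 0 ∧ h (suc n))) (f 0 ∧ ((g ∘ suc) ⊛ h) n) (((f ∘ suc) ⊛ (g ⊛ h)) n)) ⟩
    (f 0 ∧ (g 0 ∧ h (suc n)) xor f 0 ∧ ((g ∘ suc) ⊛ h) n) xor ((f ∘ suc) ⊛ (g ⊛ h)) n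
      ≡⟨ cong (_xor ((f ∘ suc) ⊛ (g ⊛ h)) n) (sym (∧-distribˡ-xor (f 0) (g 0 ∧ h (suc n)) (((g ∘ suc) ⊛ h) n))) ⟩
    (f ⊛ (g ⊛ h)) (suc n) ∎
    where open ≡-Reasoning

  ⊛-sucʳ : ∀ f g n → (f ⊛ g) (suc n) ≡ f (suc n) ∧ g 0 xor (f ⊛ (g ∘ suc)) n
  ⊛-sucʳ f g zero    = xor-comm (f 0 ∧ g 1) (f 1 ∧ g 0)
  ⊛-sucʳ f g (suc n) =
    trans (cong (f 0 ∧ g (suc (suc n)) xor_) (⊛-sucʳ (f ∘ suc) g n))
          (Xor.x∙yz≈y∙xz (f 0 ∧ g (suc (suc n))) (f (suc (suc n)) ∧ g 0) (((f ∘ suc) ⊛ (g ∘ suc)) n))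

  ⊛-comm : ∀ f g → f ⊛ g ≗ g ⊛ f
  ⊛-comm f g zero    = ∧-comm (f 0) (g 0)
  ⊛-comm f g (suc n) =
    trans (cong₂ _xor_ (∧-comm (f 0) (g (suc n))) (⊛-comm (f ∘ suc) g n)) (sym (⊛-sucʳ g f n))

  ⊛-identityʳ : ∀ f → f ⊛ 𝟙 ≗ f
  ⊛-identityʳ f n = trans (⊛-comm f 𝟙 n) (⊛-identityˡ f n)

  ⊛-commutativeMonoid : CommutativeMonoid 0ℓ 0ℓ
  ⊛-commutativeMonoid = record
    { Carrier             = Series
    ; _≈_                 = _≗_
    ; _∙_                 = _⊛_
    ; ε                   = 𝟙
    ; isCommutativeMonoid = record
      { isMonoid = record
        { isSemigroup = record
          { isMagma = record
            { isEquivalence = record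
              { refl  = λ _ → refl
              ; sym   = λ f≗g n → sym (f≗g n)
              ; trans = λ f≗g g≗h n → trans (f≗g n) (g≗h n)
              }
            ; ∙-cong = ⊛-cong
            }
          ; assoc = ⊛-assoc
          }
        ; identity = ⊛-identityˡ , ⊛-identityʳ
        }
      ; comm = ⊛-comm
      }
    }

  dil2 : Series → Series
  dil2 f zero          = f 0
  dil2 f (suc zero)    = false
  dil2 f (suc (suc n)) = dil2 (f ∘ suc) n

  dil2-cong : f ≗ g → dil2 f ≗ dil2 g
  dil2-cong f≗g zero          = f≗g 0
  dil2-cong f≗g (suc zero)    = refl
  dil2-cong f≗g (suc (suc n)) = dil2-cong (f≗g ∘ suc) n

  -- The cross terms f₀ f_{n+2} and f_{n+2} f₀ cancel in characteristic 2.
  square-suc-suc : ∀ f n → (f ⊛ f) (suc (suc n)) ≡ ((f ∘ suc) ⊛ (f ∘ suc)) n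
  square-suc-suc f n = begin
    a xor ((f ∘ suc) ⊛ f) (suc n)   ≡⟨ cong (a xor_) (⊛-sucʳ (f ∘ suc) f n) ⟩
    a xor (f (suc (suc n)) ∧ f 0 xor c) ≡⟨ cong (λ b → a xor (b xor c)) (∧-comm (f (suc (suc n))) (f 0)) ⟩
    a xor (a xor c)                 ≡⟨ sym (xor-assoc a a c) ⟩
    (a xor a) xor c                 ≡⟨ cong (_xor c) (xor-same a) ⟩
    c                               ∎
    where
    open ≡-Reasoning
    a = f 0 ∧ f (suc (suc n))
    c = ((f ∘ suc) ⊛ (f ∘ suc)) n

  frobenius : ∀ f → f ⊛ f ≗ dil2 f
  frobenius f zero          = ∧-idem (f 0)
  frobenius f (suc zero)    = trans (cong (f 0 ∧ f 1 xor_) (∧-comm (f 1) (f 0))) (xor-same (f 0 ∧ f 1))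
  frobenius f (suc (suc n)) = trans (square-suc-suc f n) (frobenius (f ∘ suc) n)

  dil2-⊛-section : ∀ f g m {r} → r < 2 → (dil2 f ⊛ g) (2 * m + r) ≡ (f ⊛ (λ j → g (2 * j + r))) m
  dil2-⊛-section f g zero    (s≤s z≤n)       = refl
  dil2-⊛-section f g zero    (s≤s (s≤s z≤n)) = xor-identityʳ (f 0 ∧ g 1)
  dil2-⊛-section f g (suc m) {r} r<2 = begin
    (dil2 f ⊛ g) (2 * suc m + r)
      ≡⟨ cong (dil2 f ⊛ g) (2[1+m]+r m r) ⟩
    f 0 ∧ g (suc (suc (2 * m + r))) xor (dil2 (f ∘ suc) ⊛ g) (2 * m + r)
      ≡⟨ cong₂ (λ k b → f 0 ∧ g k xor b) (sym (2[1+m]+r m r)) (dil2-⊛-section (f ∘ suc) g m r<2) ⟩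
    (f ⊛ (λ j → g (2 * j + r))) (suc m) ∎
    where
    open ≡-Reasoning
    2[1+m]+r : ∀ m r → 2 * suc m + r ≡ suc (suc (2 * m + r))
    2[1+m]+r = solve-∀

  private
    module ⊛ = CommutativeMonoid ⊛-commutativeMonoid
    open CMSolver ⊛-commutativeMonoid using (Expr; solve; _⊜_) renaming (_⊕_ to _⊛′_)

  sq : Series → Series
  sq f = f ⊛ f

  sq-≗𝟙 : ∀ {f} → f ≗ 𝟙 → sq f ≗ 𝟙
  sq-≗𝟙 f≗𝟙 n = trans (⊛-cong f≗𝟙 f≗𝟙 n) (⊛-identityˡ 𝟙 n)

  sq³≗dil2³ : ∀ f → sq (sq (sq f)) ≗ dil2 (dil2 (dil2 f))
  sq³≗dil2³ f n = begin
    sq (sq (sq f)) n         ≡⟨ frobenius (sq (sq f)) n ⟩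
    dil2 (sq (sq f)) n       ≡⟨ dil2-cong (frobenius (sq f)) n ⟩
    dil2 (dil2 (sq f)) n     ≡⟨ dil2-cong (dil2-cong (frobenius f)) n ⟩
    dil2 (dil2 (dil2 f)) n   ∎
    where open ≡-Reasoning

  ⊛-inverse-frobenius : ∀ {A C} → A ⊛ C ≗ 𝟙 → C ≗ dil2 (dil2 (dil2 C)) ⊛ (A ⊛ (sq A ⊛ sq (sq A)))
  ⊛-inverse-frobenius {A} {C} A⊛C≗𝟙 = begin
    C                                  ≈⟨ ⊛.sym (⊛-identityʳ C) ⟩
    C ⊛ 𝟙                              ≈⟨ ⊛-cong {f = C} (λ _ → refl) (⊛.sym (sq-≗𝟙 (sq-≗𝟙 (sq-≗𝟙 A⊛C≗𝟙)))) ⟩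
    C ⊛ sq (sq (sq (A ⊛ C)))           ≈⟨ solve 2 (λ a c → c ⊛′ sq′ (sq′ (sq′ (a ⊛′ c)))
                                                      ⊜ sq′ (sq′ (sq′ c)) ⊛′ ((a ⊛′ (sq′ a ⊛′ sq′ (sq′ a))) ⊛′ (a ⊛′ c)))
                                                ⊛.refl A C ⟩
    sq (sq (sq C)) ⊛ (A⁷ ⊛ (A ⊛ C))    ≈⟨ ⊛-cong (sq³≗dil2³ C) (⊛-cong {f = A⁷} (λ _ → refl) A⊛C≗𝟙) ⟩
    dil2 (dil2 (dil2 C)) ⊛ (A⁷ ⊛ 𝟙)   ≈⟨ ⊛-cong {f = dil2 (dil2 (dil2 C))} (λ _ → refl) (⊛-identityʳ A⁷) ⟩
    dil2 (dil2 (dil2 C)) ⊛ A⁷          ∎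
    where
    open SetoidReasoning ⊛.setoid
    A⁷ = A ⊛ (sq A ⊛ sq (sq A))
    sq′ : ∀ {n} → Expr n → Expr n
    sq′ e = e ⊛′ e

  ⊛-inverse-section : ∀ A C R → A ⊛ C ≗ 𝟙 →
    (∀ j → (A ⊛ (sq A ⊛ sq (sq A))) (8 * j + 5) ≡ (A ⊛ R) j) →
    ∀ m → C (8 * m + 5) ≡ R m
  ⊛-inverse-section A C R A⊛C≗𝟙 A⁷≡A⊛R m = begin
    C (8 * m + 5)                                ≡⟨ ⊛-inverse-frobenius A⊛C≗𝟙 (8 * m + 5) ⟩
    (dil2 (dil2 (dil2 C)) ⊛ A⁷) (8 * m + 5)      ≡⟨ cong (dil2 (dil2 (dil2 C)) ⊛ A⁷) (8m+5 m) ⟩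
    (dil2 (dil2 (dil2 C)) ⊛ A⁷) (2 * (2 * (2 * m + 1) + 0) + 1)
      ≡⟨ dil2-⊛-section (dil2 (dil2 C)) A⁷ (2 * (2 * m + 1) + 0) (s≤s (s≤s z≤n)) ⟩
    (dil2 (dil2 C) ⊛ (λ j → A⁷ (2 * j + 1))) (2 * (2 * m + 1) + 0)
      ≡⟨ dil2-⊛-section (dil2 C) _ (2 * m + 1) (s≤s z≤n) ⟩
    (dil2 C ⊛ (λ j → A⁷ (2 * (2 * j + 0) + 1))) (2 * m + 1)
      ≡⟨ dil2-⊛-section C _ m (s≤s (s≤s z≤n)) ⟩
    (C ⊛ (λ j → A⁷ (2 * (2 * (2 * j + 1) + 0) + 1))) m
      ≡⟨ ⊛-cong {f = C} (λ _ → refl) (λ j → trans (cong A⁷ (sym (8m+5 j))) (A⁷≡A⊛R j)) m ⟩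
    (C ⊛ (A ⊛ R)) m                              ≡⟨ sym (⊛-assoc C A R m) ⟩
    ((C ⊛ A) ⊛ R) m                              ≡⟨ ⊛-cong (λ n → trans (⊛-comm C A n) (A⊛C≗𝟙 n)) (λ _ → refl) m ⟩
    (𝟙 ⊛ R) m                                    ≡⟨ ⊛-identityˡ R m ⟩
    R m                                          ∎
    where
    open ≡-Reasoning
    A⁷ = A ⊛ (sq A ⊛ sq (sq A))
    8m+5 : ∀ m → 8 * m + 5 ≡ 2 * (2 * (2 * m + 1) + 0) + 1
    8m+5 = solve-∀

open PowerSeries

module Counting where
  open import Data.Bool using (true; false; _∧_; _xor_)
  open import Data.Bool.Properties using (xor-identityʳ)
  open import Data.List using (List; []; _∷_; map; upTo; applyUpTo; cartesianProduct)
  open import Data.List.Membership.Propositional using (_∈_)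
  open import Data.List.Membership.Propositional.Properties using (∈-upTo⁺; ∈-upTo⁻)
  open import Data.List.Properties using (map-upTo)
  open import Data.List.Relation.Unary.Unique.Propositional using (Unique)
  open import Data.List.Relation.Unary.Unique.Propositional.Properties using (upTo⁺)
  open import Data.Nat using (ℕ; zero; suc; _+_; _*_; _∸_; _≤_; _<_; _≟_; _≤?_; z≤n; s≤s)
  open import Data.Nat.Properties
    using (≤-pred; m≤m+n; m+[n∸m]≡n; +-cancelˡ-≡; *-cancelˡ-≡; *-distribˡ-+; +-assoc;
           +-monoʳ-<; *-monoʳ-≤; *-identityˡ; *-suc; +-comm; ≰⇒>; <⇒≢; even≢odd; module ≤-Reasoning)
  open import Data.Nat.Tactic.RingSolver using (solve-∀)
  open import Data.Product using (∃; _,_; proj₁; proj₂)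
  open import Data.Sum using (_⊎_; inj₁; inj₂)
  open import Function using (_∘_)
  open import Function.Bundles using (_⇔_; mk⇔)
  open import Relation.Binary.Definitions using (DecidableEquality)
  open import Relation.Binary.PropositionalEquality
  open import Relation.Nullary using (Dec; yes; no; does; contradiction)
  open import Relation.Nullary.Decidable using (dec-true; dec-false; does-⇔)

  private
    variable
      X Y : Set

  does⇒ : ∀ {A : Set} (a? : Dec A) → does a? ≡ true → A
  does⇒ (yes a) _ = a

  count : List X → (X → ℕ) → Series
  count xs P n = ∑ xs (λ x → does (P x ≟ n))

  count-cover : DecidableEquality X → ∀ {xs ys : List X} {P n} → Unique xs → Unique ys →
                (∀ {x} → P x ≡ n → x ∈ xs) → (∀ {x} → P x ≡ n → x ∈ ys) → count xs P n ≡ count ys P n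
  count-cover _≟ˣ_ {P = P} {n} uniqˣ uniqʸ inˣ inʸ =
    ∑-cover _≟ˣ_ uniqˣ uniqʸ (λ {x} → inˣ ∘ does⇒ (P x ≟ n)) (λ {x} → inʸ ∘ does⇒ (P x ≟ n))

  ⊛-as-∑ : ∀ f g n → (f ⊛ g) n ≡ ∑ (upTo (suc n)) (λ i → f i ∧ g (n ∸ i))
  ⊛-as-∑ f g zero    = sym (trans (∑-∷ 0 []) (trans (cong (f 0 ∧ g 0 xor_) ∑-[]) (xor-identityʳ (f 0 ∧ g 0))))
  ⊛-as-∑ f g (suc n) = begin
    f 0 ∧ g (suc n) xor ((f ∘ suc) ⊛ g) n
      ≡⟨ cong (f 0 ∧ g (suc n) xor_) (⊛-as-∑ (f ∘ suc) g n) ⟩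
    f 0 ∧ g (suc n) xor ∑ (upTo (suc n)) (λ i → F (suc i))
      ≡⟨ cong (f 0 ∧ g (suc n) xor_) (∑-map suc (upTo (suc n))) ⟨
    f 0 ∧ g (suc n) xor ∑ (map suc (upTo (suc n))) F
      ≡⟨ cong (λ is → f 0 ∧ g (suc n) xor ∑ is F) (map-upTo suc (suc n)) ⟩
    F 0 xor ∑ (applyUpTo suc (suc n)) F
      ≡⟨ ∑-∷ 0 (applyUpTo suc (suc n)) ⟨
    ∑ (upTo (suc (suc n))) F ∎
    where
    open ≡-Reasoning
    F = λ i → f i ∧ g (suc n ∸ i)

  even⊎odd : ∀ n → ∃ λ i → n ≡ 2 * i ⊎ n ≡ suc (2 * i)
  even⊎odd zero = 0 , inj₁ refl
  even⊎odd (suc n) with even⊎odd n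
  ... | i , inj₁ refl = i , inj₂ refl
  ... | i , inj₂ refl = suc i , inj₁ (sym (*-suc 2 i))

  dil2-even : ∀ f i → dil2 f (2 * i) ≡ f i
  dil2-even f zero    = refl
  dil2-even f (suc i) = trans (cong (dil2 f) (*-suc 2 i)) (dil2-even (f ∘ suc) i)

  dil2-odd : ∀ f i → dil2 f (suc (2 * i)) ≡ false
  dil2-odd f zero    = refl
  dil2-odd f (suc i) = trans (cong (dil2 f ∘ suc) (*-suc 2 i)) (dil2-odd (f ∘ suc) i)

  dil2-count : ∀ (xs : List X) P → dil2 (count xs P) ≗ count xs (λ x → 2 * P x)
  dil2-count xs P n with even⊎odd n
  ... | i , inj₁ refl = trans (dil2-even (count xs P) i)
                              (∑-cong (λ {x} _ → does-⇔ (mk⇔ (cong (2 *_)) (*-cancelˡ-≡ (P x) i 2)) (P x ≟ i) (2 * P x ≟ 2 * i)))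
  ... | i , inj₂ refl = trans (dil2-odd (count xs P) i) (sym (∑-zero (λ {x} _ → dec-false (2 * P x ≟ suc (2 * i)) (even≢odd (P x) i))))

  a*p+q≡a*m+b⇒p≤m : ∀ {a b m p q} → b < a → a * p + q ≡ a * m + b → p ≤ m
  a*p+q≡a*m+b⇒p≤m {a} {b} {m} {p} {q} b<a eq with p ≤? m
  ... | yes p≤m = p≤m
  ... | no  p≰m = contradiction eq (≢-sym (<⇒≢ (begin-strict
    a * m + b  <⟨ +-monoʳ-< (a * m) b<a ⟩
    a * m + a  ≡⟨ trans (+-comm (a * m) a) (sym (*-suc a m)) ⟩
    a * suc m  ≤⟨ *-monoʳ-≤ a (≰⇒> p≰m) ⟩
    a * p      ≤⟨ m≤m+n (a * p) q ⟩
    a * p + q  ∎)))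
    where open ≤-Reasoning

  a*p+q≡a*m+b⇔ : ∀ {a b m p q} → p ≤ m → q ≡ a * (m ∸ p) + b ⇔ a * p + q ≡ a * m + b
  a*p+q≡a*m+b⇔ {a} {b} {m} {p} {q} p≤m = mk⇔ shift unshift
    where
    shift : ∀ {q} → q ≡ a * (m ∸ p) + b → a * p + q ≡ a * m + b
    shift refl = trans (sym (+-assoc (a * p) (a * (m ∸ p)) b))
                       (cong (_+ b) (trans (sym (*-distribˡ-+ a p (m ∸ p))) (cong (a *_) (m+[n∸m]≡n p≤m))))
    unshift : a * p + q ≡ a * m + b → q ≡ a * (m ∸ p) + b
    unshift eq = +-cancelˡ-≡ (a * p) q (a * (m ∸ p) + b) (trans eq (sym (shift refl)))

  count-⊛ : ∀ {a b} → b < a → ∀ (xs : List X) (ys : List Y) P Q m →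
            (count xs P ⊛ (λ k → count ys Q (a * k + b))) m ≡
            count (cartesianProduct xs ys) (λ p → a * P (proj₁ p) + Q (proj₂ p)) (a * m + b)
  count-⊛ {a = a} {b} b<a xs ys P Q m = begin
    (count xs P ⊛ G) m
      ≡⟨ ⊛-as-∑ (count xs P) G m ⟩
    ∑ (upTo (suc m)) (λ i → count xs P i ∧ G (m ∸ i))
      ≡⟨ ∑-cong (λ {i} _ → ∑-∧ (G (m ∸ i)) xs) ⟩
    ∑ (upTo (suc m)) (λ i → ∑ xs (λ x → does (P x ≟ i) ∧ G (m ∸ i)))
      ≡⟨ ∑-comm (upTo (suc m)) xs _ ⟩
    ∑ xs (λ x → ∑ (upTo (suc m)) (λ i → does (P x ≟ i) ∧ G (m ∸ i)))
      ≡⟨ ∑-cong (λ {x} _ → fibre (P x)) ⟩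
    ∑ xs (λ x → ∑ ys (λ y → does (a * P x + Q y ≟ a * m + b)))
      ≡⟨ ∑-cartesianProduct xs ys _ ⟨
    count (cartesianProduct xs ys) (λ p → a * P (proj₁ p) + Q (proj₂ p)) (a * m + b) ∎
    where
    open ≡-Reasoning
    G = λ k → count ys Q (a * k + b)
    fibre : ∀ p → ∑ (upTo (suc m)) (λ i → does (p ≟ i) ∧ G (m ∸ i)) ≡ ∑ ys (λ y → does (a * p + Q y ≟ a * m + b))
    fibre p with p ≤? m
    ... | yes p≤m = begin
      ∑ (upTo (suc m)) (λ i → does (p ≟ i) ∧ G (m ∸ i))
        ≡⟨ ∑-single (upTo⁺ (suc m)) (∈-upTo⁺ (s≤s p≤m))
                    (λ {i} _ i≢p → cong (_∧ G (m ∸ i)) (dec-false (p ≟ i) (≢-sym i≢p))) ⟩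
      does (p ≟ p) ∧ G (m ∸ p)
        ≡⟨ cong (_∧ G (m ∸ p)) (dec-true (p ≟ p) refl) ⟩
      G (m ∸ p)
        ≡⟨ ∑-cong (λ {y} _ → does-⇔ (a*p+q≡a*m+b⇔ {a} {b} p≤m) (Q y ≟ a * (m ∸ p) + b) (a * p + Q y ≟ a * m + b)) ⟩
      ∑ ys (λ y → does (a * p + Q y ≟ a * m + b)) ∎
    ... | no p≰m =
      trans (∑-zero (λ {i} i∈ → cong (_∧ G (m ∸ i)) (dec-false (p ≟ i) (λ { refl → p≰m (≤-pred (∈-upTo⁻ i∈)) }))))
            (sym (∑-zero (λ {y} _ → dec-false (a * p + Q y ≟ a * m + b) (p≰m ∘ a*p+q≡a*m+b⇒p≤m b<a))))

  count-⊛₁ : ∀ (xs : List X) (ys : List Y) P Q →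
             count xs P ⊛ count ys Q ≗ count (cartesianProduct xs ys) (λ p → P (proj₁ p) + Q (proj₂ p))
  count-⊛₁ xs ys P Q m = begin
    (count xs P ⊛ count ys Q) m
      ≡⟨ ⊛-cong {f = count xs P} (λ _ → refl) (λ k → cong (count ys Q) (sym (1*k+0 k))) m ⟩
    (count xs P ⊛ (λ k → count ys Q (1 * k + 0))) m
      ≡⟨ count-⊛ {a = 1} {b = 0} (s≤s z≤n) xs ys P Q m ⟩
    count (cartesianProduct xs ys) (λ p → 1 * P (proj₁ p) + Q (proj₂ p)) (1 * m + 0)
      ≡⟨ ∑-cong (λ {p} _ → cong₂ (λ u v → does (u + Q (proj₂ p) ≟ v)) (*-identityˡ (P (proj₁ p))) (1*k+0 m)) ⟩
    count (cartesianProduct xs ys) (λ p → P (proj₁ p) + Q (proj₂ p)) m ∎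
    where
    open ≡-Reasoning
    1*k+0 : ∀ k → 1 * k + 0 ≡ k
    1*k+0 = solve-∀

open Counting

module IntegerParity where
  open import Data.Bool using (Bool; true; false; _∧_; _xor_)
  open import Data.Integer using (ℤ; +_; -[1+_]; _+_; _*_; -_; _-_; ∣_∣)
  open import Data.Integer.DivMod using (_%ℕ_; _/ℕ_; n%ℕd<d; a≡a%ℕn+[a/ℕn]*n)
  open import Data.Integer.Divisibility using (_∣_)
  open import Data.Integer.Properties using (*-comm; abs-*; +-identityˡ)
  open import Data.Integer.Tactic.RingSolver using (solve-∀)
  open import Data.Nat as ℕ using (zero; suc; _≡ᵇ_; s≤s)
  import Data.Nat.Divisibility as ℕ∣
  open ℕ∣ using (m∣m*n)
  open import Data.Product using (∃; _,_)
  open import Relation.Binary.PropositionalEquality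
  open import Relation.Nullary using (contradiction)

  bit : Bool → ℤ
  bit false = + 0
  bit true  = + 1

  HasParity : ℤ → Bool → Set
  HasParity z b = ∃ λ q → z ≡ bit b + + 2 * q

  parity : ℤ → Bool
  parity z = z %ℕ 2 ≡ᵇ 1

  parity-spec : ∀ z → HasParity z (parity z)
  parity-spec z with z %ℕ 2 | n%ℕd<d z 2 | a≡a%ℕn+[a/ℕn]*n z 2
  ... | 0 | _ | z≡ = z /ℕ 2 , trans z≡ (cong (_+_ (+ 0)) (*-comm (z /ℕ 2) (+ 2)))
  ... | 1 | _ | z≡ = z /ℕ 2 , trans z≡ (cong (_+_ (+ 1)) (*-comm (z /ℕ 2) (+ 2)))
  ... | suc (suc _) | s≤s (s≤s ()) | _

  1≢2* : ∀ k → + 1 ≢ + 2 * k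
  1≢2* k eq = 1≢*2 k (trans eq (*-comm (+ 2) k))
    where
    1≢*2 : ∀ k → + 1 ≢ k * + 2
    1≢*2 (+ zero)  ()
    1≢*2 (+ suc _) ()
    1≢*2 -[1+ _ ]  ()

  parity-unique : ∀ {z b} → HasParity z b → parity z ≡ b
  parity-unique {z} {b} (q , z≡) with parity z | parity-spec z
  ... | b′ | q′ , z≡′ = bits (trans (sym z≡′) z≡)
    where
    open ≡-Reasoning
    add-sub : ∀ x q → (x + + 2 * q) - + 2 * q ≡ x
    add-sub = solve-∀
    halve : ∀ q q′ → (+ 0 + + 2 * q) - + 2 * q′ ≡ + 2 * (q - q′)
    halve = solve-∀
    bits : ∀ {b′ b q′ q} → bit b′ + + 2 * q′ ≡ bit b + + 2 * q → b′ ≡ b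
    bits {false} {false} _  = refl
    bits {true}  {true}  _  = refl
    bits {false} {true} {q′} {q} eq = contradiction (begin
      + 1                        ≡⟨ add-sub (+ 1) q ⟨
      (+ 1 + + 2 * q) - + 2 * q   ≡⟨ cong (_- + 2 * q) eq ⟨
      (+ 0 + + 2 * q′) - + 2 * q  ≡⟨ halve q′ q ⟩
      + 2 * (q′ - q)              ∎) (1≢2* (q′ - q))
    bits {true}  {false} {q′} {q} eq = contradiction (begin
      + 1                        ≡⟨ add-sub (+ 1) q′ ⟨
      (+ 1 + + 2 * q′) - + 2 * q′ ≡⟨ cong (_- + 2 * q′) eq ⟩
      (+ 0 + + 2 * q) - + 2 * q′  ≡⟨ halve q q′ ⟩
      + 2 * (q - q′)              ∎) (1≢2* (q - q′))

  HasParity-+ : ∀ {x y a b} → HasParity x a → HasParity y b → HasParity (x + y) (a xor b)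
  HasParity-+ {a = a} {b} (q , refl) (q′ , refl) = q + q′ + bit (a ∧ b) , (begin
    (bit a + + 2 * q) + (bit b + + 2 * q′)            ≡⟨ regroup (bit a) (bit b) q q′ ⟩
    (bit a + bit b) + + 2 * (q + q′)                  ≡⟨ cong (_+ + 2 * (q + q′)) (carry a b) ⟩
    (bit (a xor b) + + 2 * bit (a ∧ b)) + + 2 * (q + q′) ≡⟨ absorb (bit (a xor b)) (bit (a ∧ b)) (q + q′) ⟩
    bit (a xor b) + + 2 * (q + q′ + bit (a ∧ b))      ∎)
    where
    open ≡-Reasoning
    carry : ∀ a b → bit a + bit b ≡ bit (a xor b) + + 2 * bit (a ∧ b)
    carry false false = refl
    carry false true  = refl
    carry true  false = refl
    carry true  true  = refl
    regroup : ∀ x y q q′ → (x + + 2 * q) + (y + + 2 * q′) ≡ (x + y) + + 2 * (q + q′)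
    regroup = solve-∀
    absorb : ∀ z w s → (z + + 2 * w) + + 2 * s ≡ z + + 2 * (s + w)
    absorb = solve-∀

  HasParity-* : ∀ {x y a b} → HasParity x a → HasParity y b → HasParity (x * y) (a ∧ b)
  HasParity-* {a = a} {b} (q , refl) (q′ , refl) = bit a * q′ + q * bit b + + 2 * q * q′ , (begin
    (bit a + + 2 * q) * (bit b + + 2 * q′)                    ≡⟨ expand (bit a) (bit b) q q′ ⟩
    bit a * bit b + + 2 * (bit a * q′ + q * bit b + + 2 * q * q′) ≡⟨ cong (_+ + 2 * (bit a * q′ + q * bit b + + 2 * q * q′)) (product a b) ⟩
    bit (a ∧ b) + + 2 * (bit a * q′ + q * bit b + + 2 * q * q′)   ∎)
    where
    open ≡-Reasoning
    product : ∀ a b → bit a * bit b ≡ bit (a ∧ b)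
    product false false = refl
    product false true  = refl
    product true  false = refl
    product true  true  = refl
    expand : ∀ x y q q′ → (x + + 2 * q) * (y + + 2 * q′) ≡ x * y + + 2 * (x * q′ + q * y + + 2 * q * q′)
    expand = solve-∀

  HasParity-neg : ∀ {x a} → HasParity x a → HasParity (- x) a
  HasParity-neg {a = a} (q , refl) = - bit a - q , negate (bit a) q
    where
    negate : ∀ x q → - (x + + 2 * q) ≡ x + + 2 * (- x - q)
    negate = solve-∀

  parity-+ : ∀ x y → parity (x + y) ≡ parity x xor parity y
  parity-+ x y = parity-unique (HasParity-+ {a = parity x} {parity y} (parity-spec x) (parity-spec y))

  parity-* : ∀ x y → parity (x * y) ≡ parity x ∧ parity y
  parity-* x y = parity-unique (HasParity-* {a = parity x} {parity y} (parity-spec x) (parity-spec y))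

  parity-neg : ∀ x → parity (- x) ≡ parity x
  parity-neg x = parity-unique (HasParity-neg {a = parity x} (parity-spec x))

  parity-- : ∀ x y → parity (x - y) ≡ parity x xor parity y
  parity-- x y = trans (parity-+ x (- y)) (cong (parity x xor_) (parity-neg y))

  parity-false : ∀ {z} → parity z ≡ false → ∃ λ k → z ≡ + 2 * k
  parity-false {z} even with parity z | parity-spec z
  ... | false | k , z≡ = k , trans z≡ (+-identityˡ (+ 2 * k))

  parity-true : ∀ {z} → parity z ≡ true → ∃ λ k → z ≡ + 1 + + 2 * k
  parity-true {z} odd with parity z | parity-spec z
  ... | true | k , z≡ = k , z≡

  parity-false⇒2∣ : ∀ {z} → parity z ≡ false → + 2 ∣ z
  parity-false⇒2∣ {z} even with parity-false {z} even
  ... | k , z≡2k = subst (2 ℕ∣.∣_) (sym (trans (cong ∣_∣ z≡2k) (abs-* (+ 2) k))) (m∣m*n ∣ k ∣)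

open IntegerParity

module PsiCoefficients where
  open import Data.Bool using (true; false; _∧_; _xor_)
  open import Data.Bool.Properties using (xor-same)
  open import Data.Integer as ℤ using (ℤ; +_; -[1+_]; ∣_∣)
  import Data.Integer.Properties as ℤ
  open import Data.List using (List; []; _∷_; _++_; map; upTo; applyUpTo; zipWith)
  open import Data.List.Membership.Propositional using (_∈_)
  open import Data.List.Membership.Propositional.Properties using (∈-map⁺; ∈-map⁻; ∈-++⁺ˡ; ∈-++⁺ʳ; ∈-upTo⁺)
  open import Data.List.Properties using (map-upTo)
  open import Data.List.Relation.Unary.Unique.Propositional using (Unique)
  open import Data.List.Relation.Unary.Unique.Propositional.Properties using (upTo⁺; map⁺; ++⁺)
  open import Data.Nat as ℕ using (ℕ; zero; suc; _+_; _*_; _∸_; _≤_; _≟_; _≡ᵇ_; s≤s)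
  open import Data.Nat.DivMod using (_/_; _%_; +-distrib-/-∣ˡ; m*n/n≡m)
  open import Data.Nat.Divisibility using (n∣m*n)
  import Data.Nat.Properties as ℕ
  open import Data.Nat.Tactic.RingSolver using (solve-∀)
  open import Data.Product using (_×_; _,_)
  open import Function using (_∘_)
  open import Relation.Binary.PropositionalEquality
  open import Relation.Nullary using (¬_; does)

  open import Defs

  range : ℕ → List ℤ
  range B = map +_ (upTo (suc B)) ++ map -[1+_] (upTo B)

  range-unique : ∀ B → Unique (range B)
  range-unique B = ++⁺ (map⁺ ℤ.+-injective (upTo⁺ (suc B))) (map⁺ ℤ.-[1+-injective (upTo⁺ B)) disjoint
    where
    disjoint : ∀ {z} → ¬ (z ∈ map +_ (upTo (suc B)) × z ∈ map -[1+_] (upTo B))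
    disjoint (z∈⁺ , z∈⁻) with ∈-map⁻ +_ z∈⁺ | ∈-map⁻ -[1+_] z∈⁻
    ... | _ , _ , refl | _ , _ , ()

  ∈-range : ∀ {B z} → ∣ z ∣ ≤ B → z ∈ range B
  ∈-range {B} {+ n}      n≤B = ∈-++⁺ˡ (∈-map⁺ +_ (∈-upTo⁺ (s≤s n≤B)))
  ∈-range {B} { -[1+ n ] } n<B = ∈-++⁺ʳ (map +_ (upTo (suc B))) (∈-map⁺ -[1+_] (∈-upTo⁺ n<B))

  -- 7 z² + 6 z, written on the two constructors of ℤ.
  ψ-exp : ℤ → ℕ
  ψ-exp (+ n)    = 7 * (n * n) + 6 * n
  ψ-exp -[1+ n ] = 7 * (n * n) + 8 * n + 1

  ∣z∣≤ψ-exp : ∀ z → ∣ z ∣ ≤ ψ-exp z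
  ∣z∣≤ψ-exp (+ n)    = ℕ.≤-trans (ℕ.m≤n*m n 6) (ℕ.m≤n+m (6 * n) (7 * (n * n)))
  ∣z∣≤ψ-exp -[1+ n ] = subst (_≤ ψ-exp -[1+ n ]) (ℕ.+-comm n 1)
    (ℕ.+-monoˡ-≤ 1 (ℕ.≤-trans (ℕ.m≤n*m n 8) (ℕ.m≤n+m (8 * n) (7 * (n * n)))))

  tri-suc : ∀ n → tri (suc n) ≡ suc n + tri n
  tri-suc n = begin
    suc n * suc (suc n) / 2         ≡⟨ cong (_/ 2) (expand n) ⟩
    (suc n * 2 + n * suc n) / 2     ≡⟨ +-distrib-/-∣ˡ (n * suc n) (n∣m*n (suc n)) ⟩
    suc n * 2 / 2 + n * suc n / 2   ≡⟨ cong (_+ tri n) (m*n/n≡m (suc n) 2) ⟩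
    suc n + tri n                   ∎
    where
    open ≡-Reasoning
    expand : ∀ n → suc n * suc (suc n) ≡ suc n * 2 + n * suc n
    expand = solve-∀

  2*tri : ∀ n → 2 * tri n ≡ n * suc n
  2*tri zero    = refl
  2*tri (suc n) = begin
    2 * tri (suc n)        ≡⟨ cong (2 *_) (tri-suc n) ⟩
    2 * (suc n + tri n)    ≡⟨ ℕ.*-distribˡ-+ 2 (suc n) (tri n) ⟩
    2 * suc n + 2 * tri n  ≡⟨ cong (_+_ (2 * suc n)) (2*tri n) ⟩
    2 * suc n + n * suc n  ≡⟨ expand n ⟩
    suc n * suc (suc n)    ∎
    where
    open ≡-Reasoning
    expand : ∀ n → 2 * suc n + n * suc n ≡ suc n * suc (suc n)
    expand = solve-∀

  exponent⁺ : ∀ n → 13 * tri n + 1 * tri (n ∸ 1) ≡ ψ-exp (+ n)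
  exponent⁺ zero    = refl
  exponent⁺ (suc n) = ℕ.*-cancelˡ-≡ _ _ 2 (begin
    2 * (13 * tri (suc n) + 1 * tri n)             ≡⟨ regroup (tri (suc n)) (tri n) ⟩
    13 * (2 * tri (suc n)) + 2 * tri n             ≡⟨ cong₂ (λ a b → 13 * a + b) (2*tri (suc n)) (2*tri n) ⟩
    13 * (suc n * suc (suc n)) + n * suc n         ≡⟨ expand n ⟩
    2 * (7 * (suc n * suc n) + 6 * suc n)          ∎)
    where
    open ≡-Reasoning
    regroup : ∀ a b → 2 * (13 * a + 1 * b) ≡ 13 * (2 * a) + 2 * b
    regroup = solve-∀
    expand : ∀ n → 13 * (suc n * suc (suc n)) + n * suc n ≡ 2 * (7 * (suc n * suc n) + 6 * suc n)
    expand = solve-∀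

  exponent⁻ : ∀ n → 13 * tri n + 1 * tri (suc n) ≡ ψ-exp -[1+ n ]
  exponent⁻ n = ℕ.*-cancelˡ-≡ _ _ 2 (begin
    2 * (13 * tri n + 1 * tri (suc n))             ≡⟨ regroup (tri n) (tri (suc n)) ⟩
    13 * (2 * tri n) + 2 * tri (suc n)             ≡⟨ cong₂ (λ a b → 13 * a + b) (2*tri n) (2*tri (suc n)) ⟩
    13 * (n * suc n) + suc n * suc (suc n)         ≡⟨ expand n ⟩
    2 * (7 * (n * n) + 8 * n + 1)                  ∎)
    where
    open ≡-Reasoning
    regroup : ∀ a b → 2 * (13 * a + 1 * b) ≡ 13 * (2 * a) + 2 * b
    regroup = solve-∀
    expand : ∀ n → 13 * (n * suc n) + suc n * suc (suc n) ≡ 2 * (7 * (n * n) + 8 * n + 1)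
    expand = solve-∀

  parity-zsum : ∀ xs → parity (zsum xs) ≡ ∑ xs parity
  parity-zsum []       = sym ∑-[]
  parity-zsum (x ∷ xs) = trans (parity-+ x (zsum xs)) (trans (cong (parity x xor_) (parity-zsum xs)) (sym (∑-∷ x xs)))

  parity-at : ∀ e N v → parity v ≡ true → parity (at e N v) ≡ does (e ≟ N)
  parity-at e N v odd with e ≡ᵇ N
  ... | true  = odd
  ... | false = refl

  parity-sgn : ∀ k → parity (sgn k) ≡ true
  parity-sgn k with k % 2 ≡ᵇ 0
  ... | true  = refl
  ... | false = refl

  Ψ₂ : Series
  Ψ₂ N = parity (psiCoeff 13 1 N)

  Ψ₂-count : ∀ N → Ψ₂ N ≡ count (range N) ψ-exp N
  Ψ₂-count N = begin
    parity (zsum (map F (upTo (suc N))) ℤ.- zsum (map G (upTo N)))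
      ≡⟨ parity-- (zsum (map F (upTo (suc N)))) (zsum (map G (upTo N))) ⟩
    parity (zsum (map F (upTo (suc N)))) xor parity (zsum (map G (upTo N)))
      ≡⟨ cong₂ _xor_ (parity-zsum (map F (upTo (suc N)))) (parity-zsum (map G (upTo N))) ⟩
    ∑ (map F (upTo (suc N))) parity xor ∑ (map G (upTo N)) parity
      ≡⟨ cong₂ _xor_ (∑-map F (upTo (suc N))) (∑-map G (upTo N)) ⟩
    ∑ (upTo (suc N)) (parity ∘ F) xor ∑ (upTo N) (parity ∘ G)
      ≡⟨ cong₂ _xor_ (∑-cong (λ {n} _ → trans (parity-at (13 * tri n + 1 * tri (n ∸ 1)) N (sgn (tri n)) (parity-sgn (tri n)))
                                              (cong (λ e → does (e ≟ N)) (exponent⁺ n))))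
                     (∑-cong (λ {n} _ → trans (parity-at (13 * tri n + 1 * tri (suc n)) N (sgn (tri n)) (parity-sgn (tri n)))
                                              (cong (λ e → does (e ≟ N)) (exponent⁻ n)))) ⟩
    ∑ (upTo (suc N)) (λ n → does (ψ-exp (+ n) ≟ N)) xor ∑ (upTo N) (λ n → does (ψ-exp -[1+ n ] ≟ N))
      ≡⟨ cong₂ _xor_ (∑-map +_ (upTo (suc N))) (∑-map -[1+_] (upTo N)) ⟨
    ∑ (map +_ (upTo (suc N))) (λ z → does (ψ-exp z ≟ N)) xor ∑ (map -[1+_] (upTo N)) (λ z → does (ψ-exp z ≟ N))
      ≡⟨ ∑-++ (map +_ (upTo (suc N))) ⟨
    count (range N) ψ-exp N ∎
    where
    open ≡-Reasoning
    F = λ n → at (13 * tri n + 1 * tri (n ∸ 1)) N (sgn (tri n))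
    G = λ n → at (13 * tri n + 1 * tri (suc n)) N (sgn (tri n))

  Ψ₂≡count : ∀ {k B} → k ≤ B → Ψ₂ k ≡ count (range B) ψ-exp k
  Ψ₂≡count {k} {B} k≤B = trans (Ψ₂-count k)
    (count-cover ℤ._≟_ (range-unique k) (range-unique B)
                 (λ {z} e → ∈-range (bound {z} e)) (λ {z} e → ∈-range (ℕ.≤-trans (bound {z} e) k≤B)))
    where
    bound : ∀ {z} → ψ-exp z ≡ k → ∣ z ∣ ≤ k
    bound {z} refl = ∣z∣≤ψ-exp z

  c₂ : Series
  c₂ N = parity (c 13 1 N)

  cRev≡applyUpTo : ∀ r s N → cRev r s N ≡ applyUpTo (λ i → c r s (N ∸ i)) (suc N)
  cRev≡applyUpTo r s zero    = refl
  cRev≡applyUpTo r s (suc N) = cong (c r s (suc N) ∷_) (cRev≡applyUpTo r s N)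

  zipWith-applyUpTo : ∀ {X Y Z : Set} (h : X → Y → Z) f g n →
                      zipWith h (applyUpTo f n) (applyUpTo g n) ≡ applyUpTo (λ i → h (f i) (g i)) n
  zipWith-applyUpTo h f g zero    = refl
  zipWith-applyUpTo h f g (suc n) = cong (h (f 0) (g 0) ∷_) (zipWith-applyUpTo h (f ∘ suc) (g ∘ suc) n)

  c-recurrence : ∀ r s N → parity (c r s (suc N)) ≡ ((λ i → parity (psiCoeff r s (suc i))) ⊛ (parity ∘ c r s)) N
  c-recurrence r s N = begin
    parity (ℤ.- zsum (zipWith ℤ._*_ (map ψ′ (upTo (suc N))) (cRev r s N)))
      ≡⟨ parity-neg (zsum (zipWith ℤ._*_ (map ψ′ (upTo (suc N))) (cRev r s N))) ⟩
    parity (zsum (zipWith ℤ._*_ (map ψ′ (upTo (suc N))) (cRev r s N)))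
      ≡⟨ cong₂ (λ xs ys → parity (zsum (zipWith ℤ._*_ xs ys))) (map-upTo ψ′ (suc N)) (cRev≡applyUpTo r s N) ⟩
    parity (zsum (zipWith ℤ._*_ (applyUpTo ψ′ (suc N)) (applyUpTo c′ (suc N))))
      ≡⟨ cong (parity ∘ zsum) (zipWith-applyUpTo ℤ._*_ ψ′ c′ (suc N)) ⟩
    parity (zsum (applyUpTo term (suc N)))
      ≡⟨ parity-zsum (applyUpTo term (suc N)) ⟩
    ∑ (applyUpTo term (suc N)) parity
      ≡⟨ cong (λ xs → ∑ xs parity) (map-upTo term (suc N)) ⟨
    ∑ (map term (upTo (suc N))) parity
      ≡⟨ ∑-map term (upTo (suc N)) ⟩
    ∑ (upTo (suc N)) (parity ∘ term)
      ≡⟨ ∑-cong (λ {i} _ → parity-* (ψ′ i) (c′ i)) ⟩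
    ∑ (upTo (suc N)) (λ i → parity (ψ′ i) ∧ parity (c′ i))
      ≡⟨ ⊛-as-∑ (parity ∘ ψ′) (parity ∘ c r s) N ⟨
    ((parity ∘ ψ′) ⊛ (parity ∘ c r s)) N ∎
    where
    open ≡-Reasoning
    ψ′ = λ i → psiCoeff r s (suc i)
    c′ = λ i → c r s (N ∸ i)
    term = λ i → ψ′ i ℤ.* c′ i

  -- Ψ₂ 0 computes to true, so the first term of (Ψ₂ ⊛ c₂) (suc N) is c₂ (suc N) itself.
  Ψ₂⊛c₂≗𝟙 : Ψ₂ ⊛ c₂ ≗ 𝟙
  Ψ₂⊛c₂≗𝟙 zero    = refl
  Ψ₂⊛c₂≗𝟙 (suc N) = trans (cong (_xor ((Ψ₂ ∘ suc) ⊛ c₂) N) (c-recurrence 13 1 N)) (xor-same (((Ψ₂ ∘ suc) ⊛ c₂) N))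

open PsiCoefficients

module NumberTheory where
  open import Data.Empty using (⊥)
  open import Data.List using (applyUpTo; _∷ʳ_)
  open import Data.List.Properties using (applyUpTo-∷ʳ)
  open import Data.Nat.ListAction using (sum)
  open import Data.Nat.ListAction.Properties using (sum-++)
  open import Data.Nat
  open import Data.Nat.Combinatorics using (_C_; nCk+nC[k+1]≡[n+1]C[k+1]; nCn≡1; k>n⇒nCk≡0; nCk≡n!/k![n-k]!; k![n∸k]!∣n!)
  open import Data.Nat.DivMod using (_/_; _%_; %-distribˡ-*; m/n*n≡m; m≡m%n+[m/n]*n; m<n⇒m%n≡m; m%n<n)
  open import Data.Nat.Divisibility
  open import Data.Nat.Primality using (Prime; euclidsLemma; prime⇒nonTrivial; prime⇒nonZero)
  open import Data.Nat.Properties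
  open import Data.Nat.Tactic.RingSolver using (solve-∀)
  open import Data.Product using (∃; _,_)
  open import Data.Sum using (inj₁; inj₂)
  open import Function using (_∘_)
  open import Relation.Binary.PropositionalEquality
  open import Relation.Nullary using (¬_; yes; no; contradiction)

  private
    variable
      p : ℕ

  prime⇒1<p : Prime p → 1 < p
  prime⇒1<p {p} pr = nonTrivial⇒n>1 p {{prime⇒nonTrivial pr}}

  prime∤m! : ∀ {m} → Prime p → m < p → ¬ p ∣ m !
  prime∤m! {p} {zero}  pr _   p∣1 = <⇒≢ (prime⇒1<p pr) (sym (∣1⇒≡1 p∣1))
  prime∤m! {p} {suc m} pr m<p p∣m! with euclidsLemma (suc m) (m !) pr p∣m!
  ... | inj₁ p∣1+m = <⇒≱ m<p (∣⇒≤ p∣1+m)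
  ... | inj₂ p∣m!  = prime∤m! pr (<-trans (n<1+n m) m<p) p∣m!

  n∣n! : ∀ n → 0 < n → n ∣ n !
  n∣n! (suc n) _ = m∣m*n (n !)

  nCk*k![n∸k]!≡n! : ∀ {n k} → k ≤ n → (n C k) * (k ! * (n ∸ k) !) ≡ n !
  nCk*k![n∸k]!≡n! {n} {k} k≤n = trans (cong (_* (k ! * (n ∸ k) !)) (nCk≡n!/k![n-k]! k≤n)) (m/n*n≡m (k![n∸k]!∣n! k≤n))
    where instance _ = k !* (n ∸ k) !≢0

  prime∣pCk : ∀ {k} → Prime p → 0 < k → k < p → p ∣ p C k
  prime∣pCk {p} {k} pr 0<k k<p with euclidsLemma (p C k) (k ! * (p ∸ k) !) pr p∣p!
    where
    p∣p! : p ∣ (p C k) * (k ! * (p ∸ k) !)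
    p∣p! = subst (p ∣_) (sym (nCk*k![n∸k]!≡n! (<⇒≤ k<p))) (n∣n! p (<-trans 0<k k<p))
  ... | inj₁ p∣pCk = p∣pCk
  ... | inj₂ p∣k![p∸k]! with euclidsLemma (k !) ((p ∸ k) !) pr p∣k![p∸k]!
  ... | inj₁ p∣k! = contradiction p∣k! (prime∤m! pr k<p)
  ... | inj₂ p∣[p∸k]! = contradiction p∣[p∸k]! (prime∤m! pr (∸-monoʳ-< 0<k (<⇒≤ k<p)))

  sum-applyUpTo-cong : ∀ n {f g} → (∀ k → f k ≡ g k) → sum (applyUpTo f n) ≡ sum (applyUpTo g n)
  sum-applyUpTo-cong zero    f≗g = refl
  sum-applyUpTo-cong (suc n) f≗g = cong₂ _+_ (f≗g 0) (sum-applyUpTo-cong n (f≗g ∘ suc))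

  sum-applyUpTo-+ : ∀ n f g → sum (applyUpTo (λ k → f k + g k) n) ≡ sum (applyUpTo f n) + sum (applyUpTo g n)
  sum-applyUpTo-+ zero    f g = refl
  sum-applyUpTo-+ (suc n) f g = trans (cong (f 0 + g 0 +_) (sum-applyUpTo-+ n (f ∘ suc) (g ∘ suc)))
                                      (interchange (f 0) (g 0) (sum (applyUpTo (f ∘ suc) n)) (sum (applyUpTo (g ∘ suc) n)))
    where
    interchange : ∀ a b c d → (a + b) + (c + d) ≡ (a + c) + (b + d)
    interchange = solve-∀

  *-sum-applyUpTo : ∀ n a f → a * sum (applyUpTo f n) ≡ sum (applyUpTo (λ k → a * f k) n)
  *-sum-applyUpTo zero    a f = *-zeroʳ a
  *-sum-applyUpTo (suc n) a f = trans (*-distribˡ-+ a (f 0) (sum (applyUpTo (f ∘ suc) n))) (cong (a * f 0 +_) (*-sum-applyUpTo n a (f ∘ suc)))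

  ∣-sum-applyUpTo : ∀ {d} n f → (∀ {k} → k < n → d ∣ f k) → d ∣ sum (applyUpTo f n)
  ∣-sum-applyUpTo zero    f d∣f = _ ∣0
  ∣-sum-applyUpTo (suc n) f d∣f = ∣m∣n⇒∣m+n (d∣f z<s) (∣-sum-applyUpTo n (f ∘ suc) (d∣f ∘ s<s))

  sum-applyUpTo-∷ʳ : ∀ n f → sum (applyUpTo f (suc n)) ≡ sum (applyUpTo f n) + f n
  sum-applyUpTo-∷ʳ n f = begin
    sum (applyUpTo f (suc n))           ≡⟨ cong sum (applyUpTo-∷ʳ f n) ⟨
    sum (applyUpTo f n ∷ʳ f n)          ≡⟨ sum-++ (applyUpTo f n) _ ⟩
    sum (applyUpTo f n) + (f n + 0)     ≡⟨ cong (sum (applyUpTo f n) +_) (+-identityʳ (f n)) ⟩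
    sum (applyUpTo f n) + f n           ∎
    where open ≡-Reasoning

  binomial : ∀ n a → (1 + a) ^ n ≡ sum (applyUpTo (λ k → (n C k) * a ^ k) (suc n))
  binomial zero    a = refl
  binomial (suc n) a = sym (begin
    1 + sum (applyUpTo (λ k → (suc n C suc k) * a ^ suc k) (suc n))
      ≡⟨ cong (1 +_) (trans (sum-applyUpTo-cong (suc n) (λ k → trans (cong (_* a ^ suc k) (sym (nCk+nC[k+1]≡[n+1]C[k+1] n k)))
                                                     (distrib (n C k) (n C suc k) a (a ^ k))))
                            (sum-applyUpTo-+ (suc n) (λ k → a * ((n C k) * a ^ k)) (λ k → (n C suc k) * a ^ suc k))) ⟩
    1 + (sum (applyUpTo (λ k → a * ((n C k) * a ^ k)) (suc n)) + U)
      ≡⟨ cong (λ x → 1 + (x + U)) (*-sum-applyUpTo (suc n) a (λ k → (n C k) * a ^ k)) ⟨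
    1 + (a * S + U)
      ≡⟨ rearrange (a * S) U ⟩
    a * S + (1 + U)
      ≡⟨ cong (λ x → a * S + (1 + x)) (trans (sum-applyUpTo-∷ʳ n (λ k → (n C suc k) * a ^ suc k))
                                             (cong (sum (applyUpTo (λ k → (n C suc k) * a ^ suc k) n) +_) last≡0)) ⟩
    a * S + (1 + (sum (applyUpTo (λ k → (n C suc k) * a ^ suc k) n) + 0))
      ≡⟨ cong (λ x → a * S + (1 + x)) (+-identityʳ (sum (applyUpTo (λ k → (n C suc k) * a ^ suc k) n))) ⟩
    a * S + S
      ≡⟨ +-comm (a * S) S ⟩
    (1 + a) * S
      ≡⟨ cong ((1 + a) *_) (binomial n a) ⟨
    (1 + a) ^ suc n ∎)
    where
    open ≡-Reasoning
    S = sum (applyUpTo (λ k → (n C k) * a ^ k) (suc n))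
    U = sum (applyUpTo (λ k → (n C suc k) * a ^ suc k) (suc n))
    last≡0 : (n C suc n) * a ^ suc n ≡ 0
    last≡0 = cong (_* a ^ suc n) (k>n⇒nCk≡0 (n<1+n n))
    distrib : ∀ x y a b → (x + y) * (a * b) ≡ a * (x * b) + y * (a * b)
    distrib = solve-∀
    rearrange : ∀ x y → 1 + (x + y) ≡ x + (1 + y)
    rearrange = solve-∀

  freshman : Prime p → ∀ a → ∃ λ M → (1 + a) ^ p ≡ 1 + M * p + a ^ p
  freshman {zero}  pr a = contradiction (prime⇒1<p pr) λ ()
  freshman {suc n} pr a with ∣-sum-applyUpTo n middle (λ {k} k<n → ∣m⇒∣m*n (a ^ suc k) (prime∣pCk pr z<s (s<s k<n)))
    where
    middle = λ k → (suc n C suc k) * a ^ suc k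
  ... | divides M middle≡M*p = M , (begin
    (1 + a) ^ suc n                                              ≡⟨ binomial (suc n) a ⟩
    1 + sum (applyUpTo middle (suc n))                           ≡⟨ cong (1 +_) (sum-applyUpTo-∷ʳ n middle) ⟩
    1 + (sum (applyUpTo middle n) + (suc n C suc n) * a ^ suc n) ≡⟨ cong₂ (λ x y → 1 + (x + y * a ^ suc n)) middle≡M*p (nCn≡1 (suc n)) ⟩
    1 + (M * suc n + 1 * a ^ suc n)                              ≡⟨ cong (λ x → 1 + (M * suc n + x)) (*-identityˡ (a ^ suc n)) ⟩
    1 + (M * suc n + a ^ suc n)                                  ≡⟨ +-assoc 1 (M * suc n) (a ^ suc n) ⟨
    1 + M * suc n + a ^ suc n                                    ∎)
    where
    open ≡-Reasoning
    middle = λ k → (suc n C suc k) * a ^ suc k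

  fermat-little : Prime p → ∀ a → ∃ λ q → a ^ p ≡ a + q * p
  fermat-little {zero}  pr a       = contradiction (prime⇒1<p pr) λ ()
  fermat-little {suc n} pr zero    = 0 , refl
  fermat-little {suc n} pr (suc a) with freshman pr a | fermat-little pr a
  ... | M , step | q , a^p≡ = M + q , (begin
    (1 + a) ^ suc n                    ≡⟨ step ⟩
    1 + M * suc n + a ^ suc n          ≡⟨ cong (1 + M * suc n +_) a^p≡ ⟩
    1 + M * suc n + (a + q * suc n)    ≡⟨ regroup a M q (suc n) ⟩
    suc a + (M + q) * suc n            ∎)
    where
    open ≡-Reasoning
    regroup : ∀ a M q p → 1 + M * p + (a + q * p) ≡ suc a + (M + q) * p
    regroup = solve-∀

  fermat : Prime p → ∀ {a} → ¬ p ∣ a → ∃ λ q → a ^ (p ∸ 1) ≡ 1 + q * p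
  fermat {zero}  pr p∤a = contradiction (prime⇒1<p pr) λ ()
  fermat {suc n} pr {zero} p∤0 = contradiction (_ ∣0) p∤0
  fermat {suc n} pr {suc a} p∤a with fermat-little pr (suc a)
  ... | q , a^p≡ with euclidsLemma (suc a) (suc a ^ n ∸ 1) pr (divides q a[a^n∸1]≡q*p)
    where
    a[a^n∸1]≡q*p : suc a * (suc a ^ n ∸ 1) ≡ q * suc n
    a[a^n∸1]≡q*p = begin
      suc a * (suc a ^ n ∸ 1)         ≡⟨ *-distribˡ-∸ (suc a) (suc a ^ n) 1 ⟩
      suc a * suc a ^ n ∸ suc a * 1   ≡⟨ cong₂ _∸_ a^p≡ (*-identityʳ (suc a)) ⟩
      suc a + q * suc n ∸ suc a       ≡⟨ m+n∸m≡n (suc a) (q * suc n) ⟩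
      q * suc n                       ∎
      where open ≡-Reasoning
  ... | inj₁ p∣a              = contradiction p∣a p∤a
  ... | inj₂ (divides r a^n∸1≡r*p) = r , trans (sym (m+[n∸m]≡n (positive n))) (cong (1 +_) a^n∸1≡r*p)
    where
    positive : ∀ n → 1 ≤ suc a ^ n
    positive zero    = ≤-refl
    positive (suc n) = ≤-trans (positive n) (m≤m+n (suc a ^ n) (a * suc a ^ n))

  x+y∣x^odd+y^odd : ∀ h x y → x + y ∣ x ^ (2 * h + 1) + y ^ (2 * h + 1)
  x+y∣x^odd+y^odd zero    x y = subst (x + y ∣_) (cong₂ _+_ (sym (*-identityʳ x)) (sym (*-identityʳ y))) ∣-refl
  x+y∣x^odd+y^odd (suc h) x y = subst (x + y ∣_) (sym x^[2h+3]+y^[2h+3])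
    (∣m+n∣m⇒∣n (subst (x + y ∣_) (expand x y X Y) (m∣m*n (x * X + y * Y))) (∣-trans (x+y∣x^odd+y^odd h x y) (n∣m*n (x * y))))
    where
    X = x ^ (2 * h + 1)
    Y = y ^ (2 * h + 1)
    2[1+h]+1 : 2 * suc h + 1 ≡ suc (suc (2 * h + 1))
    2[1+h]+1 = lemma h
      where
      lemma : ∀ h → 2 * suc h + 1 ≡ suc (suc (2 * h + 1))
      lemma = solve-∀
    x^[2h+3]+y^[2h+3] : x ^ (2 * suc h + 1) + y ^ (2 * suc h + 1) ≡ x * (x * X) + y * (y * Y)
    x^[2h+3]+y^[2h+3] = cong₂ _+_ (cong (x ^_) 2[1+h]+1) (cong (y ^_) 2[1+h]+1)
    expand : ∀ x y X Y → (x + y) * (x * X + y * Y) ≡ x * y * (X + Y) + (x * (x * X) + y * (y * Y))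
    expand = solve-∀

  ^-double : ∀ x m → x ^ (2 * m) ≡ (x * x) ^ m
  ^-double x m = trans (sym (^-*-assoc x 2 m)) (cong (λ y → (x * y) ^ m) (*-identityʳ x))

  prime∣x²+y²⇒prime∣x : Prime p → p % 4 ≡ 3 → ∀ {x y} → p ∣ x * x + y * y → p ∣ x
  prime∣x²+y²⇒prime∣x {p} pr p%4≡3 {x} {y} p∣x²+y² with p ∣? x
  ... | yes p∣x = p∣x
  ... | no  p∤x with fermat pr p∤x | fermat pr p∤y
    where
    p∤y : ¬ p ∣ y
    p∤y p∣y with euclidsLemma x x pr (∣m+n∣m⇒∣n (subst (p ∣_) (+-comm (x * x) (y * y)) p∣x²+y²) (∣m⇒∣m*n y p∣y))
    ... | inj₁ p∣x = p∤x p∣x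
    ... | inj₂ p∣x = p∤x p∣x
  ... | q₁ , x^[p∸1]≡ | q₂ , y^[p∸1]≡ = contradiction (∣⇒≤ p∣2) (<⇒≱ 2<p)
    where
    h = p / 4
    p≡4h+3 : p ≡ 3 + h * 4
    p≡4h+3 = trans (m≡m%n+[m/n]*n p 4) (cong (_+ h * 4) p%4≡3)
    2<p : 2 < p
    2<p = subst (2 <_) (sym p≡4h+3) (s≤s (s≤s (s≤s z≤n)))
    p∸1≡ : p ∸ 1 ≡ 2 * (2 * h + 1)
    p∸1≡ = trans (cong (_∸ 1) p≡4h+3) (lemma h)
      where
      lemma : ∀ h → 2 + h * 4 ≡ 2 * (2 * h + 1)
      lemma = solve-∀
    p∣x^[p∸1]+y^[p∸1] : p ∣ x ^ (p ∸ 1) + y ^ (p ∸ 1)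
    p∣x^[p∸1]+y^[p∸1] = subst (p ∣_)
      (cong₂ _+_ (trans (sym (^-double x (2 * h + 1))) (cong (x ^_) (sym p∸1≡))) (trans (sym (^-double y (2 * h + 1))) (cong (y ^_) (sym p∸1≡))))
      (∣-trans p∣x²+y² (x+y∣x^odd+y^odd h (x * x) (y * y)))
    p∣2 : p ∣ 2
    p∣2 = ∣m+n∣m⇒∣n (subst (p ∣_) (trans (cong₂ _+_ x^[p∸1]≡ y^[p∸1]≡) (regroup q₁ q₂ p)) p∣x^[p∸1]+y^[p∸1]) (n∣m*n (q₁ + q₂))
      where
      regroup : ∀ a b p → 1 + a * p + (1 + b * p) ≡ (a + b) * p + 2
      regroup = solve-∀

  x²+y²≢p^[2k+1]*m : Prime p → p % 4 ≡ 3 → ∀ {m} → ¬ p ∣ m → ∀ k x y → x * x + y * y ≢ p ^ (2 * k + 1) * m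
  x²+y²≢p^[2k+1]*m {p} pr p%4≡3 {m} p∤m k x y eq
    with prime∣x²+y²⇒prime∣x pr p%4≡3 {x} {y} p∣x²+y²
       | prime∣x²+y²⇒prime∣x pr p%4≡3 {y} {x} (subst (p ∣_) (+-comm (x * x) (y * y)) p∣x²+y²)
    where
    p∣x²+y² : p ∣ x * x + y * y
    p∣x²+y² = subst (p ∣_) (sym eq) (∣m⇒∣m*n m (subst (λ e → p ∣ p ^ e) (+-comm 1 (2 * k)) (m∣m*n (p ^ (2 * k)))))
  ... | divides x′ refl | divides y′ refl = descend k eq
    where
    instance
      _ = prime⇒nonZero pr
      _ = m*n≢0 p p
    S = x′ * x′ + y′ * y′
    squares : ∀ a b p → (a * p) * (a * p) + (b * p) * (b * p) ≡ (a * a + b * b) * (p * p)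
    squares = solve-∀
    descend : ∀ k → (x′ * p) * (x′ * p) + (y′ * p) * (y′ * p) ≡ p ^ (2 * k + 1) * m → ⊥
    descend zero    eq = p∤m (divides S (*-cancelʳ-≡ m (S * p) p
      (trans (sym (trans eq (unit p m))) (trans (squares x′ y′ p) (sym (*-assoc S p p))))))
      where
      unit : ∀ p m → p * 1 * m ≡ m * p
      unit = solve-∀
    descend (suc k) eq = x²+y²≢p^[2k+1]*m pr p%4≡3 p∤m k x′ y′
      (*-cancelʳ-≡ S (p ^ (2 * k + 1) * m) (p * p) (trans (sym (squares x′ y′ p)) (trans eq p^[2k+3]m)))
      where
      2[1+k]+1 : ∀ k → 2 * suc k + 1 ≡ suc (suc (2 * k + 1))
      2[1+k]+1 = solve-∀
      shift : ∀ a p m → p * (p * a) * m ≡ a * m * (p * p)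
      shift = solve-∀
      p^[2k+3]m : p ^ (2 * suc k + 1) * m ≡ p ^ (2 * k + 1) * m * (p * p)
      p^[2k+3]m = trans (cong (λ e → p ^ e * m) (2[1+k]+1 k)) (shift (p ^ (2 * k + 1)) p m)

  m%d≡1⇒m^n%d≡1 : ∀ {m d} .{{_ : NonZero d}} → m % d ≡ 1 → ∀ n → m ^ n % d ≡ 1
  m%d≡1⇒m^n%d≡1 {m} {d} m%d≡1 zero    = m<n⇒m%n≡m (subst (_< d) m%d≡1 (m%n<n m d))
  m%d≡1⇒m^n%d≡1 {m} {d} m%d≡1 (suc n) = begin
    (m * m ^ n) % d              ≡⟨ %-distribˡ-* m (m ^ n) d ⟩
    (m % d * (m ^ n % d)) % d    ≡⟨ cong₂ (λ a b → (a * b) % d) m%d≡1 (m%d≡1⇒m^n%d≡1 m%d≡1 n) ⟩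
    1 % d                        ≡⟨ m%d≡1⇒m^n%d≡1 m%d≡1 zero ⟩
    1                            ∎
    where open ≡-Reasoning

  prime∤a*n+b*p : ∀ a b {n} → Prime p → ¬ p ∣ a → ¬ p ∣ n → ¬ p ∣ a * n + b * p
  prime∤a*n+b*p {p} a b {n} pr p∤a p∤n p∣ with euclidsLemma a n pr (∣m+n∣m⇒∣n (subst (p ∣_) (+-comm (a * n) (b * p)) p∣) (n∣m*n b))
  ... | inj₁ p∣a = p∤a p∣a
  ... | inj₂ p∣n = p∤n p∣n

open NumberTheory

module Lattice where
  open import Data.Bool using (true; false; _∧_; _xor_)
  open import Data.Bool.Properties using (∧-idem; xor-comm; xor-identityʳ)
  open import Data.Integer as ℤ using (ℤ; +_; -[1+_]; ∣_∣; _+_; _*_; -_; _-_)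
  import Data.Integer.Properties as ℤ
  open import Data.Integer.Tactic.RingSolver using (solve-∀)
  open import Data.List using (List; map; cartesianProduct)
  open import Data.List.Membership.Propositional using (_∈_)
  open import Data.List.Membership.Propositional.Properties using (∈-cartesianProduct⁺; ∈-map⁺)
  open import Data.List.Relation.Unary.Unique.Propositional using (Unique)
  open import Data.List.Relation.Unary.Unique.Propositional.Properties using (cartesianProduct⁺; map⁺)
  open import Data.Nat as ℕ using (ℕ; _≤_; _<_; z≤n; s≤s)
  open import Data.Nat.Divisibility using (_∣_)
  open import Data.Nat.Primality using (Prime)
  import Data.Nat.Properties as ℕ
  import Data.Nat.Tactic.RingSolver as ℕ-Solver
  open import Data.Product using (∃; _×_; _,_; proj₁; proj₂)
  open import Data.Product.Properties using (≡-dec)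
  open import Function using (_∘_)
  open import Function.Bundles using (_⇔_; mk⇔; module Equivalence)
  open import Relation.Binary.PropositionalEquality
  open import Relation.Nullary using (¬_)
  open import Relation.Nullary.Decidable using (does-⇔; dec-false)

  ψ-expℤ : ℤ → ℤ
  ψ-expℤ z = + 7 * (z * z) + + 6 * z

  L : ℤ × (ℤ × ℤ) → ℤ × (ℤ × ℤ)
  L (d , s , t) = (+ 2 * t - + 2 * d - + 1 , + 2 * s , - t - d - + 1)

  parity-ψ-expℤ : ∀ z → parity (ψ-expℤ z) ≡ parity z
  parity-ψ-expℤ z = begin
    parity (+ 7 * (z * z) + + 6 * z)             ≡⟨ parity-+ (+ 7 * (z * z)) (+ 6 * z) ⟩
    parity (+ 7 * (z * z)) xor parity (+ 6 * z)  ≡⟨ cong₂ _xor_ (parity-* (+ 7) (z * z)) (parity-* (+ 6) z) ⟩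
    parity (z * z) xor false                     ≡⟨ xor-identityʳ (parity (z * z)) ⟩
    parity (z * z)                               ≡⟨ parity-* z z ⟩
    parity z ∧ parity z                          ≡⟨ ∧-idem (parity z) ⟩
    parity z                                     ∎
    where open ≡-Reasoning

  parity-+2* : ∀ x y → parity (x + + 2 * y) ≡ parity x
  parity-+2* x y = trans (parity-+ x (+ 2 * y)) (trans (cong (parity x xor_) (parity-* (+ 2) y)) (xor-identityʳ (parity x)))

  2*≡0 : ∀ {x} → + 2 * x ≡ + 0 → x ≡ + 0
  2*≡0 {x} eq = ℤ.*-cancelˡ-≡ (+ 2) x (+ 0) (trans eq (sym (ℤ.*-zeroʳ (+ 2))))

  e₁₂₄ℤ : ℤ → ℤ → ℤ → ℤ
  e₁₂₄ℤ a b c = ψ-expℤ a + (+ 2 * ψ-expℤ b + + 2 * (+ 2 * ψ-expℤ c))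

  private
    a-odd : ∀ {a b c j} → e₁₂₄ℤ a b c ≡ + 8 * j + + 5 → parity a ≡ true
    a-odd {a} {b} {c} {j} eq = begin
      parity a                                               ≡⟨ parity-ψ-expℤ a ⟨
      parity (ψ-expℤ a)                                      ≡⟨ parity-+2* (ψ-expℤ a) (ψ-expℤ b + + 2 * ψ-expℤ c) ⟨
      parity (ψ-expℤ a + + 2 * (ψ-expℤ b + + 2 * ψ-expℤ c))  ≡⟨ cong parity (regroup (ψ-expℤ a) (ψ-expℤ b) (ψ-expℤ c)) ⟩
      parity (e₁₂₄ℤ a b c)                                   ≡⟨ cong parity eq ⟩
      parity (+ 8 * j + + 5)                                 ≡⟨ parity-+ (+ 8 * j) (+ 5) ⟩
      parity (+ 8 * j) xor true                              ≡⟨ cong (_xor true) (parity-* (+ 8) j) ⟩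
      true                                                   ∎
      where
      open ≡-Reasoning
      regroup : ∀ x y z → x + + 2 * (y + + 2 * z) ≡ x + (+ 2 * y + + 2 * (+ 2 * z))
      regroup = solve-∀

    halve-odd-a : ∀ u {b c j} → e₁₂₄ℤ (+ 1 + + 2 * u) b c ≡ + 8 * j + + 5 →
                  ψ-expℤ b + + 2 * (ψ-expℤ c + + 7 * (u * u) + + 10 * u + + 2 - + 2 * j) ≡ + 0
    halve-odd-a u {b} {c} {j} eq = 2*≡0 (trans (sym (expand u (ψ-expℤ b) (ψ-expℤ c) j)) (ℤ.i≡j⇒i-j≡0 eq))
      where
      expand : ∀ u eb ec j → (+ 7 * ((+ 1 + + 2 * u) * (+ 1 + + 2 * u)) + + 6 * (+ 1 + + 2 * u))
                               + (+ 2 * eb + + 2 * (+ 2 * ec)) - (+ 8 * j + + 5)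
                             ≡ + 2 * (eb + + 2 * (ec + + 7 * (u * u) + + 10 * u + + 2 - + 2 * j))
      expand = solve-∀

    b-even : ∀ {b y} → ψ-expℤ b + + 2 * y ≡ + 0 → parity b ≡ false
    b-even {b} {y} eq = trans (sym (parity-ψ-expℤ b)) (trans (sym (parity-+2* (ψ-expℤ b) y)) (cong parity eq))

    halve-even-b : ∀ {s u c j} → ψ-expℤ (+ 2 * s) + + 2 * (ψ-expℤ c + + 7 * (u * u) + + 10 * u + + 2 - + 2 * j) ≡ + 0 →
                   (ψ-expℤ c + + 7 * (u * u)) + + 2 * (+ 7 * (s * s) + + 3 * s + + 5 * u + + 1 - j) ≡ + 0
    halve-even-b {s} {u} {c} {j} eq = 2*≡0 (trans (sym (expand s u (ψ-expℤ c) j)) eq)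
      where
      expand : ∀ s u ec j → (+ 7 * ((+ 2 * s) * (+ 2 * s)) + + 6 * (+ 2 * s)) + + 2 * (ec + + 7 * (u * u) + + 10 * u + + 2 - + 2 * j)
                            ≡ + 2 * ((ec + + 7 * (u * u)) + + 2 * (+ 7 * (s * s) + + 3 * s + + 5 * u + + 1 - j))
      expand = solve-∀

    u+c-even : ∀ {u c y} → (ψ-expℤ c + + 7 * (u * u)) + + 2 * y ≡ + 0 → parity (u + c) ≡ false
    u+c-even {u} {c} {y} eq = begin
      parity (u + c)                                 ≡⟨ parity-+ u c ⟩
      parity u xor parity c                          ≡⟨ xor-comm (parity u) (parity c) ⟩
      parity c xor parity u                          ≡⟨ cong₂ _xor_ (parity-ψ-expℤ c) parity-7u² ⟨
      parity (ψ-expℤ c) xor parity (+ 7 * (u * u))   ≡⟨ parity-+ (ψ-expℤ c) (+ 7 * (u * u)) ⟨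
      parity (ψ-expℤ c + + 7 * (u * u))              ≡⟨ parity-+2* (ψ-expℤ c + + 7 * (u * u)) y ⟨
      parity (ψ-expℤ c + + 7 * (u * u) + + 2 * y)    ≡⟨ cong parity eq ⟩
      false                                          ∎
      where
      open ≡-Reasoning
      parity-7u² : parity (+ 7 * (u * u)) ≡ parity u
      parity-7u² = trans (parity-* (+ 7) (u * u)) (trans (parity-* u u) (∧-idem (parity u)))

  -- Reducing e₁₂₄ℤ a b c ≡ 8 j + 5 modulo 2, 4 and 8 in turn shows that a is odd, b is even and
  -- (a + 1) / 2 + c is odd, which is exactly the image of L.
  L-preimage : ∀ a b c j → e₁₂₄ℤ a b c ≡ + 8 * j + + 5 → ∃ λ y → (a , b , c) ≡ L y
  L-preimage a b c j eq = (- w - + 1 , s , u - w) , cong₂ _,_ (trans a≡ (a≡L u w)) (cong₂ _,_ b≡ c≡)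
    where
    open ≡-Reasoning
    a-odd′ = a-odd {a} {b} {c} {j} eq
    u = proj₁ (parity-true {a} a-odd′)
    a≡ = proj₂ (parity-true {a} a-odd′)
    eq₁ = halve-odd-a u {b} {c} {j} (subst (λ a → e₁₂₄ℤ a b c ≡ + 8 * j + + 5) a≡ eq)
    s = proj₁ (parity-false {b} (b-even {b} eq₁))
    b≡ = proj₂ (parity-false {b} (b-even {b} eq₁))
    eq₂ = halve-even-b {s} {u} {c} {j} (subst (λ b → ψ-expℤ b + + 2 * (ψ-expℤ c + + 7 * (u * u) + + 10 * u + + 2 - + 2 * j) ≡ + 0) b≡ eq₁)
    w = proj₁ (parity-false {u + c} (u+c-even {u} {c} eq₂))
    u+c≡2w = proj₂ (parity-false {u + c} (u+c-even {u} {c} eq₂))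
    a≡L : ∀ u w → + 1 + + 2 * u ≡ + 2 * (u - w) - + 2 * (- w - + 1) - + 1
    a≡L = solve-∀
    c≡ : c ≡ - (u - w) - (- w - + 1) - + 1
    c≡ = begin
      c                             ≡⟨ cancelˡ u c ⟨
      (u + c) - u                   ≡⟨ cong (_- u) u+c≡2w ⟩
      + 2 * w - u                   ≡⟨ rearrange u w ⟩
      - (u - w) - (- w - + 1) - + 1 ∎
      where
      cancelˡ : ∀ u c → (u + c) - u ≡ c
      cancelˡ = solve-∀
      rearrange : ∀ u w → + 2 * w - u ≡ - (u - w) - (- w - + 1) - + 1
      rearrange = solve-∀

  -- -[1+ n ] is definitionally - (+ 1 + + n), so the ring solver can treat the negative case.
  ψ-exp-cast : ∀ z → + ψ-exp z ≡ ψ-expℤ z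
  ψ-exp-cast (+ n) = trans (ℤ.pos-+ (7 ℕ.* (n ℕ.* n)) (6 ℕ.* n))
                           (cong₂ _+_ (trans (ℤ.pos-* 7 (n ℕ.* n)) (cong (+ 7 *_) (ℤ.pos-* n n))) (ℤ.pos-* 6 n))
  ψ-exp-cast -[1+ n ] = begin
    + (7 ℕ.* (n ℕ.* n) ℕ.+ 8 ℕ.* n ℕ.+ 1)     ≡⟨ ℤ.pos-+ (7 ℕ.* (n ℕ.* n) ℕ.+ 8 ℕ.* n) 1 ⟩
    + (7 ℕ.* (n ℕ.* n) ℕ.+ 8 ℕ.* n) + + 1     ≡⟨ cong (_+ + 1) (ℤ.pos-+ (7 ℕ.* (n ℕ.* n)) (8 ℕ.* n)) ⟩
    + (7 ℕ.* (n ℕ.* n)) + + (8 ℕ.* n) + + 1   ≡⟨ cong₂ (λ x y → x + y + + 1) (trans (ℤ.pos-* 7 (n ℕ.* n)) (cong (+ 7 *_) (ℤ.pos-* n n)))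
                                                                            (ℤ.pos-* 8 n) ⟩
    + 7 * (+ n * + n) + + 8 * + n + + 1       ≡⟨ negate (+ n) ⟩
    ψ-expℤ -[1+ n ]                           ∎
    where
    open ≡-Reasoning
    negate : ∀ x → + 7 * (x * x) + + 8 * x + + 1 ≡ + 7 * ((- (+ 1 + x)) * (- (+ 1 + x))) + + 6 * (- (+ 1 + x))
    negate = solve-∀

  ∣14z+3∣ ∣14z+2∣ : ℤ → ℕ
  ∣14z+3∣ (+ n)    = 3 ℕ.+ 14 ℕ.* n
  ∣14z+3∣ -[1+ n ] = 11 ℕ.+ 14 ℕ.* n
  ∣14z+2∣ (+ n)    = 2 ℕ.+ 14 ℕ.* n
  ∣14z+2∣ -[1+ n ] = 12 ℕ.+ 14 ℕ.* n

  private
    +[r+14n] : ∀ r n → + (r ℕ.+ 14 ℕ.* n) ≡ + 14 * + n + + r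
    +[r+14n] r n = trans (ℤ.pos-+ r (14 ℕ.* n)) (trans (cong (_+_ (+ r)) (ℤ.pos-* 14 n)) (ℤ.+-comm (+ r) (+ 14 * + n)))

    +[m*m] : ∀ {m x} → + m ≡ x → + (m ℕ.* m) ≡ x * x
    +[m*m] {m} refl = ℤ.pos-* m m

  ∣14z+3∣²-cast : ∀ z → + (∣14z+3∣ z ℕ.* ∣14z+3∣ z) ≡ (+ 14 * z + + 3) * (+ 14 * z + + 3)
  ∣14z+3∣²-cast (+ n)    = +[m*m] (+[r+14n] 3 n)
  ∣14z+3∣²-cast -[1+ n ] = trans (+[m*m] (+[r+14n] 11 n)) (negate (+ n))
    where
    negate : ∀ x → (+ 14 * x + + 11) * (+ 14 * x + + 11) ≡ (+ 14 * (- (+ 1 + x)) + + 3) * (+ 14 * (- (+ 1 + x)) + + 3)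
    negate = solve-∀

  ∣14z+2∣²-cast : ∀ z → + (∣14z+2∣ z ℕ.* ∣14z+2∣ z) ≡ (+ 14 * z + + 2) * (+ 14 * z + + 2)
  ∣14z+2∣²-cast (+ n)    = +[m*m] (+[r+14n] 2 n)
  ∣14z+2∣²-cast -[1+ n ] = trans (+[m*m] (+[r+14n] 12 n)) (negate (+ n))
    where
    negate : ∀ x → (+ 14 * x + + 12) * (+ 14 * x + + 12) ≡ (+ 14 * (- (+ 1 + x)) + + 2) * (+ 14 * (- (+ 1 + x)) + + 2)
    negate = solve-∀

  private
    m≤m*m : ∀ m → .{{_ : ℕ.NonZero m}} → m ≤ m ℕ.* m
    m≤m*m m = ℕ.m≤m*n m m

  ∣z∣≤∣14z+3∣² : ∀ z → ∣ z ∣ ≤ ∣14z+3∣ z ℕ.* ∣14z+3∣ z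
  ∣z∣≤∣14z+3∣² (+ n)    = ℕ.≤-trans (ℕ.≤-trans (ℕ.m≤n*m n 14) (ℕ.m≤n+m (14 ℕ.* n) 3)) (m≤m*m (3 ℕ.+ 14 ℕ.* n))
  ∣z∣≤∣14z+3∣² -[1+ n ] = ℕ.≤-trans (ℕ.+-mono-≤ (s≤s (z≤n {10})) (ℕ.m≤n*m n 14)) (m≤m*m (11 ℕ.+ 14 ℕ.* n))

  ∣z∣≤∣14z+2∣² : ∀ z → ∣ z ∣ ≤ ∣14z+2∣ z ℕ.* ∣14z+2∣ z
  ∣z∣≤∣14z+2∣² (+ n)    = ℕ.≤-trans (ℕ.≤-trans (ℕ.m≤n*m n 14) (ℕ.m≤n+m (14 ℕ.* n) 2)) (m≤m*m (2 ℕ.+ 14 ℕ.* n))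
  ∣z∣≤∣14z+2∣² -[1+ n ] = ℕ.≤-trans (ℕ.+-mono-≤ (s≤s (z≤n {11})) (ℕ.m≤n*m n 14)) (m≤m*m (12 ℕ.+ 14 ℕ.* n))

  Q : ℤ × ℤ → ℕ
  Q p = ∣14z+3∣ (proj₁ p) ℕ.* ∣14z+3∣ (proj₁ p) ℕ.+ ∣14z+2∣ (proj₂ p) ℕ.* ∣14z+2∣ (proj₂ p)

  e₁₂₄ e₂₈Q : ℤ × (ℤ × ℤ) → ℕ
  e₁₂₄ x = ψ-exp (proj₁ x) ℕ.+ (2 ℕ.* ψ-exp (proj₁ (proj₂ x)) ℕ.+ 2 ℕ.* (2 ℕ.* ψ-exp (proj₂ (proj₂ x))))
  e₂₈Q y = 28 ℕ.* ψ-exp (proj₁ y) ℕ.+ Q (proj₂ y)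

  e₁₂₄-cast : ∀ a b c → + e₁₂₄ (a , b , c) ≡ e₁₂₄ℤ a b c
  e₁₂₄-cast a b c = begin
    + (ψ-exp a ℕ.+ (2 ℕ.* ψ-exp b ℕ.+ 2 ℕ.* (2 ℕ.* ψ-exp c)))
      ≡⟨ ℤ.pos-+ (ψ-exp a) (2 ℕ.* ψ-exp b ℕ.+ 2 ℕ.* (2 ℕ.* ψ-exp c)) ⟩
    + ψ-exp a + + (2 ℕ.* ψ-exp b ℕ.+ 2 ℕ.* (2 ℕ.* ψ-exp c))
      ≡⟨ cong (_+_ (+ ψ-exp a)) (ℤ.pos-+ (2 ℕ.* ψ-exp b) (2 ℕ.* (2 ℕ.* ψ-exp c))) ⟩
    + ψ-exp a + (+ (2 ℕ.* ψ-exp b) + + (2 ℕ.* (2 ℕ.* ψ-exp c)))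
      ≡⟨ cong₂ (λ x y → + ψ-exp a + (x + y)) (ℤ.pos-* 2 (ψ-exp b))
               (trans (ℤ.pos-* 2 (2 ℕ.* ψ-exp c)) (cong (+ 2 *_) (ℤ.pos-* 2 (ψ-exp c)))) ⟩
    + ψ-exp a + (+ 2 * + ψ-exp b + + 2 * (+ 2 * + ψ-exp c))
      ≡⟨ cong₂ (λ x y → x + y) (ψ-exp-cast a)
               (cong₂ (λ x y → + 2 * x + + 2 * (+ 2 * y)) (ψ-exp-cast b) (ψ-exp-cast c)) ⟩
    e₁₂₄ℤ a b c ∎
    where open ≡-Reasoning

  e₂₈Q-cast : ∀ d s t → + e₂₈Q (d , s , t) ≡
    + 28 * ψ-expℤ d + ((+ 14 * s + + 3) * (+ 14 * s + + 3) + (+ 14 * t + + 2) * (+ 14 * t + + 2))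
  e₂₈Q-cast d s t = trans (ℤ.pos-+ (28 ℕ.* ψ-exp d) (Q (s , t)))
    (cong₂ _+_ (trans (ℤ.pos-* 28 (ψ-exp d)) (cong (+ 28 *_) (ψ-exp-cast d)))
               (trans (ℤ.pos-+ (∣14z+3∣ s ℕ.* ∣14z+3∣ s) (∣14z+2∣ t ℕ.* ∣14z+2∣ t))
                      (cong₂ _+_ (∣14z+3∣²-cast s) (∣14z+2∣²-cast t))))

  7*e₁₂₄∘L : ∀ y → 7 ℕ.* e₁₂₄ (L y) ≡ 2 ℕ.* e₂₈Q y ℕ.+ 9
  7*e₁₂₄∘L (d , s , t) = ℤ.+-injective (begin
    + (7 ℕ.* e₁₂₄ (L (d , s , t)))         ≡⟨ ℤ.pos-* 7 (e₁₂₄ (L (d , s , t))) ⟩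
    + 7 * + e₁₂₄ (L (d , s , t))           ≡⟨ cong (+ 7 *_) (e₁₂₄-cast (+ 2 * t - + 2 * d - + 1) (+ 2 * s) (- t - d - + 1)) ⟩
    + 7 * e₁₂₄ℤ (+ 2 * t - + 2 * d - + 1) (+ 2 * s) (- t - d - + 1)
                                             ≡⟨ L-exponents d s t ⟩
    + 2 * (+ 28 * ψ-expℤ d + ((+ 14 * s + + 3) * (+ 14 * s + + 3) + (+ 14 * t + + 2) * (+ 14 * t + + 2))) + + 9
                                             ≡⟨ cong (λ x → + 2 * x + + 9) (e₂₈Q-cast d s t) ⟨
    + 2 * + e₂₈Q (d , s , t) + + 9         ≡⟨ cong (_+ + 9) (ℤ.pos-* 2 (e₂₈Q (d , s , t))) ⟨
    + (2 ℕ.* e₂₈Q (d , s , t)) + + 9       ≡⟨ ℤ.pos-+ (2 ℕ.* e₂₈Q (d , s , t)) 9 ⟨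
    + (2 ℕ.* e₂₈Q (d , s , t) ℕ.+ 9)       ∎)
    where
    open ≡-Reasoning
    L-exponents : ∀ d s t →
      + 7 * ((+ 7 * ((+ 2 * t - + 2 * d - + 1) * (+ 2 * t - + 2 * d - + 1)) + + 6 * (+ 2 * t - + 2 * d - + 1))
             + (+ 2 * (+ 7 * ((+ 2 * s) * (+ 2 * s)) + + 6 * (+ 2 * s))
                + + 2 * (+ 2 * (+ 7 * ((- t - d - + 1) * (- t - d - + 1)) + + 6 * (- t - d - + 1)))))
      ≡ + 2 * (+ 28 * (+ 7 * (d * d) + + 6 * d)
               + ((+ 14 * s + + 3) * (+ 14 * s + + 3) + (+ 14 * t + + 2) * (+ 14 * t + + 2))) + + 9
    L-exponents = solve-∀

  L-injective : ∀ {y y′} → L y ≡ L y′ → y ≡ y′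
  L-injective {d , s , t} {d′ , s′ , t′} eq = cong₂ _,_ d≡d′ (cong₂ _,_ s≡s′ t≡t′)
    where
    a≡ = cong proj₁ eq
    b≡ = cong (proj₁ ∘ proj₂) eq
    c≡ = cong (proj₂ ∘ proj₂) eq
    recover-t : ∀ t d → + 4 * t ≡ (+ 2 * t - + 2 * d - + 1) - + 2 * (- t - d - + 1) - + 1
    recover-t = solve-∀
    recover-d : ∀ t d → + 4 * d ≡ - (+ 2 * t - + 2 * d - + 1) - + 2 * (- t - d - + 1) - + 3
    recover-d = solve-∀
    s≡s′ : s ≡ s′
    s≡s′ = ℤ.*-cancelˡ-≡ (+ 2) s s′ b≡
    t≡t′ : t ≡ t′
    t≡t′ = ℤ.*-cancelˡ-≡ (+ 4) t t′
      (trans (recover-t t d) (trans (cong₂ (λ a c → a - + 2 * c - + 1) a≡ c≡) (sym (recover-t t′ d′))))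
    d≡d′ : d ≡ d′
    d≡d′ = ℤ.*-cancelˡ-≡ (+ 4) d d′
      (trans (recover-d t d) (trans (cong₂ (λ a c → - a - + 2 * c - + 3) a≡ c≡) (sym (recover-d t′ d′))))

  e₁₂₄∘L≡⇔ : ∀ y j → e₁₂₄ (L y) ≡ 8 ℕ.* j ℕ.+ 5 ⇔ e₂₈Q y ≡ 28 ℕ.* j ℕ.+ 13
  e₁₂₄∘L≡⇔ y j = mk⇔
    (λ eq → ℕ.*-cancelˡ-≡ (e₂₈Q y) (28 ℕ.* j ℕ.+ 13) 2 (ℕ.+-cancelʳ-≡ 9 _ _
              (trans (sym (7*e₁₂₄∘L y)) (trans (cong (7 ℕ.*_) eq) (7[8j+5] j)))))
    (λ eq → ℕ.*-cancelˡ-≡ (e₁₂₄ (L y)) (8 ℕ.* j ℕ.+ 5) 7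
              (trans (7*e₁₂₄∘L y) (trans (cong (λ x → 2 ℕ.* x ℕ.+ 9) eq) (sym (7[8j+5] j)))))
    where
    7[8j+5] : ∀ j → 7 ℕ.* (8 ℕ.* j ℕ.+ 5) ≡ 2 ℕ.* (28 ℕ.* j ℕ.+ 13) ℕ.+ 9
    7[8j+5] = ℕ-Solver.solve-∀

  square : ℕ → List (ℤ × ℤ)
  square B = cartesianProduct (range B) (range B)

  cube : ℕ → List (ℤ × (ℤ × ℤ))
  cube B = cartesianProduct (range B) (square B)

  square-unique : ∀ B → Unique (square B)
  square-unique B = cartesianProduct⁺ (range-unique B) (range-unique B)

  cube-unique : ∀ B → Unique (cube B)
  cube-unique B = cartesianProduct⁺ (range-unique B) (square-unique B)

  ∈-square : ∀ {B s t} → ∣ s ∣ ≤ B → ∣ t ∣ ≤ B → (s , t) ∈ square B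
  ∈-square s≤ t≤ = ∈-cartesianProduct⁺ (∈-range s≤) (∈-range t≤)

  ∈-cube : ∀ {B a b c} → ∣ a ∣ ≤ B → ∣ b ∣ ≤ B → ∣ c ∣ ≤ B → (a , b , c) ∈ cube B
  ∈-cube a≤ b≤ c≤ = ∈-cartesianProduct⁺ (∈-range a≤) (∈-square b≤ c≤)

  Q-bound : ∀ {B} s t → Q (s , t) ≤ B → (s , t) ∈ square B
  Q-bound s t Q≤B = ∈-square
    (ℕ.≤-trans (∣z∣≤∣14z+3∣² s) (ℕ.≤-trans (ℕ.m≤m+n _ _) Q≤B))
    (ℕ.≤-trans (∣z∣≤∣14z+2∣² t) (ℕ.≤-trans (ℕ.m≤n+m _ _) Q≤B))

  e₁₂₄-bound : ∀ {B} a b c → e₁₂₄ (a , b , c) ≤ B → (a , b , c) ∈ cube B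
  e₁₂₄-bound a b c E≤B = ∈-cube
    (ℕ.≤-trans (∣z∣≤ψ-exp a) (ℕ.≤-trans (ℕ.m≤m+n _ _) E≤B))
    (ℕ.≤-trans (∣z∣≤ψ-exp b) (ℕ.≤-trans (ℕ.m≤n*m _ 2) (ℕ.≤-trans (ℕ.m≤m+n _ _) (ℕ.≤-trans (ℕ.m≤n+m _ (ψ-exp a)) E≤B))))
    (ℕ.≤-trans (∣z∣≤ψ-exp c) (ℕ.≤-trans (ℕ.m≤n*m _ 4) (ℕ.≤-trans (ℕ.≤-reflexive (ℕ.*-assoc 2 2 (ψ-exp c)))
      (ℕ.≤-trans (ℕ.m≤n+m _ (2 ℕ.* ψ-exp b)) (ℕ.≤-trans (ℕ.m≤n+m _ (ψ-exp a)) E≤B)))))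

  e₂₈Q-bound : ∀ {B} d s t → e₂₈Q (d , s , t) ≤ B → (d , s , t) ∈ cube B
  e₂₈Q-bound d s t E≤B with Q-bound s t (ℕ.≤-trans (ℕ.m≤n+m _ (28 ℕ.* ψ-exp d)) E≤B)
  ... | st∈ = ∈-cartesianProduct⁺ (∈-range (ℕ.≤-trans (∣z∣≤ψ-exp d) (ℕ.≤-trans (ℕ.m≤n*m _ 28) (ℕ.≤-trans (ℕ.m≤m+n _ _) E≤B)))) st∈

  -- The box square (28 j + 13) contains every (s , t) with (14 s + 3)² + (14 t + 2)² = 28 j + 13.
  twoSquares : Series
  twoSquares j = count (square (28 ℕ.* j ℕ.+ 13)) Q (28 ℕ.* j ℕ.+ 13)

  twoSquares≡count : ∀ {k B} → 28 ℕ.* k ℕ.+ 13 ≤ B → twoSquares k ≡ count (square B) Q (28 ℕ.* k ℕ.+ 13)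
  twoSquares≡count {k} {B} 28k+13≤B = count-cover (≡-dec ℤ._≟_ ℤ._≟_) (square-unique (28 ℕ.* k ℕ.+ 13)) (square-unique B)
    (λ {p} eq → Q-bound (proj₁ p) (proj₂ p) (ℕ.≤-reflexive eq))
    (λ {p} eq → Q-bound (proj₁ p) (proj₂ p) (ℕ.≤-trans (ℕ.≤-reflexive eq) 28k+13≤B))

  twoSquares-vanishes : ∀ {p m M} → Prime p → p ℕ.% 4 ≡ 3 → ¬ p ∣ m →
                        ∀ k → 28 ℕ.* M ℕ.+ 13 ≡ p ℕ.^ (2 ℕ.* k ℕ.+ 1) ℕ.* m → twoSquares M ≡ false
  twoSquares-vanishes {M = M} pr p%4≡3 p∤m k 28M+13≡ = ∑-zero λ {st} _ →
    dec-false (Q st ℕ.≟ 28 ℕ.* M ℕ.+ 13)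
      (λ eq → x²+y²≢p^[2k+1]*m pr p%4≡3 p∤m k (∣14z+3∣ (proj₁ st)) (∣14z+2∣ (proj₂ st)) (trans eq 28M+13≡))

  count-e₁₂₄≡count-e₂₈Q : ∀ j {B} → 28 ℕ.* j ℕ.+ 13 ≤ B →
                          count (cube B) e₁₂₄ (8 ℕ.* j ℕ.+ 5) ≡ count (cube B) e₂₈Q (28 ℕ.* j ℕ.+ 13)
  count-e₁₂₄≡count-e₂₈Q j {B} 28j+13≤B = begin
    count (cube B) e₁₂₄ (8 ℕ.* j ℕ.+ 5)
      ≡⟨ count-cover (≡-dec ℤ._≟_ (≡-dec ℤ._≟_ ℤ._≟_)) (cube-unique B) (map⁺ L-injective (cube-unique B)) in-cube in-image ⟩
    count (map L (cube B)) e₁₂₄ (8 ℕ.* j ℕ.+ 5)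
      ≡⟨ ∑-map L (cube B) ⟩
    count (cube B) (e₁₂₄ ∘ L) (8 ℕ.* j ℕ.+ 5)
      ≡⟨ ∑-cong (λ {y} _ → does-⇔ (e₁₂₄∘L≡⇔ y j) (e₁₂₄ (L y) ℕ.≟ 8 ℕ.* j ℕ.+ 5) (e₂₈Q y ℕ.≟ 28 ℕ.* j ℕ.+ 13)) ⟩
    count (cube B) e₂₈Q (28 ℕ.* j ℕ.+ 13) ∎
    where
    open ≡-Reasoning
    8j+5≤B : 8 ℕ.* j ℕ.+ 5 ≤ B
    8j+5≤B = ℕ.≤-trans (ℕ.+-mono-≤ (ℕ.*-monoˡ-≤ j (ℕ.m≤m+n 8 20)) (ℕ.m≤m+n 5 8)) 28j+13≤B
    in-cube : ∀ {x} → e₁₂₄ x ≡ 8 ℕ.* j ℕ.+ 5 → x ∈ cube B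
    in-cube {a , b , c} eq = e₁₂₄-bound a b c (ℕ.≤-trans (ℕ.≤-reflexive eq) 8j+5≤B)
    in-image : ∀ {x} → e₁₂₄ x ≡ 8 ℕ.* j ℕ.+ 5 → x ∈ map L (cube B)
    in-image {a , b , c} eq = subst (_∈ map L (cube B)) (sym x≡Ly)
      (∈-map⁺ L (e₂₈Q-bound (proj₁ y) (proj₁ (proj₂ y)) (proj₂ (proj₂ y))
        (ℕ.≤-trans (ℕ.≤-reflexive (Equivalence.to (e₁₂₄∘L≡⇔ y j) (subst (λ x → e₁₂₄ x ≡ 8 ℕ.* j ℕ.+ 5) x≡Ly eq))) 28j+13≤B)))
      where
      e₁₂₄ℤ≡8j+5 : e₁₂₄ℤ a b c ≡ + 8 * + j + + 5
      e₁₂₄ℤ≡8j+5 = trans (sym (e₁₂₄-cast a b c)) (trans (cong +_ eq) (trans (ℤ.pos-+ (8 ℕ.* j) 5) (cong (_+ + 5) (ℤ.pos-* 8 j))))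
      y = proj₁ (L-preimage a b c (+ j) e₁₂₄ℤ≡8j+5)
      x≡Ly = proj₂ (L-preimage a b c (+ j) e₁₂₄ℤ≡8j+5)

  ψ-count⁷ : ∀ B → let 𝔸 = count (range B) ψ-exp in 𝔸 ⊛ (sq 𝔸 ⊛ sq (sq 𝔸)) ≗ count (cube B) e₁₂₄
  ψ-count⁷ B n = trans (⊛-cong {f = 𝔸} (λ _ → refl) 𝔸²⊛𝔸⁴ n)
                       (count-⊛₁ (range B) (square B) ψ-exp (λ p → 2 ℕ.* ψ-exp (proj₁ p) ℕ.+ 2 ℕ.* (2 ℕ.* ψ-exp (proj₂ p))) n)
    where
    𝔸 = count (range B) ψ-exp
    𝔸² : sq 𝔸 ≗ count (range B) (λ z → 2 ℕ.* ψ-exp z)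
    𝔸² n = trans (frobenius 𝔸 n) (dil2-count (range B) ψ-exp n)
    𝔸⁴ : sq (sq 𝔸) ≗ count (range B) (λ z → 2 ℕ.* (2 ℕ.* ψ-exp z))
    𝔸⁴ n = trans (frobenius (sq 𝔸) n) (trans (dil2-cong 𝔸² n) (dil2-count (range B) (λ z → 2 ℕ.* ψ-exp z) n))
    𝔸²⊛𝔸⁴ : sq 𝔸 ⊛ sq (sq 𝔸) ≗ count (square B) (λ p → 2 ℕ.* ψ-exp (proj₁ p) ℕ.+ 2 ℕ.* (2 ℕ.* ψ-exp (proj₂ p)))
    𝔸²⊛𝔸⁴ n = trans (⊛-cong 𝔸² 𝔸⁴ n) (count-⊛₁ (range B) (range B) (λ z → 2 ℕ.* ψ-exp z) (λ z → 2 ℕ.* (2 ℕ.* ψ-exp z)) n)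

  Ψ₂⁷-section : ∀ j → (Ψ₂ ⊛ (sq Ψ₂ ⊛ sq (sq Ψ₂))) (8 ℕ.* j ℕ.+ 5) ≡ (Ψ₂ ⊛ twoSquares) j
  Ψ₂⁷-section j = begin
    (Ψ₂ ⊛ (sq Ψ₂ ⊛ sq (sq Ψ₂))) (8 ℕ.* j ℕ.+ 5)
      ≡⟨ ⊛-cong≤ Ψ₂≐𝔸 (⊛-cong≤ (⊛-cong≤ Ψ₂≐𝔸 Ψ₂≐𝔸) (⊛-cong≤ (⊛-cong≤ Ψ₂≐𝔸 Ψ₂≐𝔸) (⊛-cong≤ Ψ₂≐𝔸 Ψ₂≐𝔸))) 8j+5≤B ⟩
    (𝔸 ⊛ (sq 𝔸 ⊛ sq (sq 𝔸))) (8 ℕ.* j ℕ.+ 5)        ≡⟨ ψ-count⁷ B (8 ℕ.* j ℕ.+ 5) ⟩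
    count (cube B) e₁₂₄ (8 ℕ.* j ℕ.+ 5)               ≡⟨ count-e₁₂₄≡count-e₂₈Q j ℕ.≤-refl ⟩
    count (cube B) e₂₈Q (28 ℕ.* j ℕ.+ 13)             ≡⟨ count-⊛ 13<28 (range B) (square B) ψ-exp Q j ⟨
    (𝔸 ⊛ (λ k → count (square B) Q (28 ℕ.* k ℕ.+ 13))) j
      ≡⟨ ⊛-cong≤ (λ k≤j → Ψ₂≐𝔸 (ℕ.≤-trans k≤j j≤B))
                 (λ {k} k≤j → twoSquares≡count {k} (ℕ.+-monoˡ-≤ 13 (ℕ.*-monoʳ-≤ 28 k≤j))) ℕ.≤-refl ⟨
    (Ψ₂ ⊛ twoSquares) j                               ∎
    where
    open ≡-Reasoning
    B = 28 ℕ.* j ℕ.+ 13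
    𝔸 = count (range B) ψ-exp
    13<28 : 13 < 28
    13<28 = ℕ.m≤m+n 14 14
    8j+5≤B : 8 ℕ.* j ℕ.+ 5 ≤ B
    8j+5≤B = ℕ.+-mono-≤ (ℕ.*-monoˡ-≤ j (ℕ.m≤m+n 8 20)) (ℕ.m≤m+n 5 8)
    j≤B : j ≤ B
    j≤B = ℕ.≤-trans (ℕ.m≤n*m j 28) (ℕ.m≤m+n (28 ℕ.* j) 13)
    Ψ₂≐𝔸 : Ψ₂ ≗[≤ B ] 𝔸
    Ψ₂≐𝔸 = Ψ₂≡count

open Lattice

open import Defs
open import Data.Bool using (false)
open import Data.Nat using (ℕ; suc; _+_; _*_; _^_)
open import Data.Nat.DivMod using (_/_; _%_; %-distribˡ-*; m∣n⇒o%n%m≡o%m; m<n⇒m%n≡m; m≡m%n+[m/n]*n; m*n/n≡m)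
open import Data.Nat.Divisibility using (_∣_; _∣?_; divides; ∣⇒≤)
open import Data.Nat.Primality using (Prime)
open import Data.Nat.Properties using (m≤n⇒m<n∨m≡n)
open import Data.Nat.Tactic.RingSolver using (solve-∀)
open import Data.Integer using (+_)
open import Data.Integer.Divisibility as ℤ∣ using ()
open import Data.Sum using (_⊎_; inj₁; inj₂; [_,_]′)
open import Relation.Nullary using (¬_)
open import Relation.Nullary.Decidable using (from-no)
open import Relation.Binary.PropositionalEquality

module _ {p} (p%28 : p % 28 ≡ 15 ⊎ p % 28 ≡ 27) where

  p%4≡3 : p % 4 ≡ 3
  p%4≡3 = trans (sym (m∣n⇒o%n%m≡o%m 4 28 p (divides 7 refl))) ([ cong (_% 4) , cong (_% 4) ]′ p%28)

  p∤28 : ¬ p ∣ 28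
  p∤28 p∣28 with m≤n⇒m<n∨m≡n (∣⇒≤ p∣28)
  ... | inj₂ refl = [ (λ ()) , (λ ()) ]′ p%28
  ... | inj₁ p<28 = [ (λ p≡15 → from-no (15 ∣? 28) (subst (_∣ 28) (trans (sym (m<n⇒m%n≡m p<28)) p≡15) p∣28))
                    , (λ p≡27 → from-no (27 ∣? 28) (subst (_∣ 28) (trans (sym (m<n⇒m%n≡m p<28)) p≡27) p∣28)) ]′ p%28

  p^[2k+2]%28≡1 : ∀ k → p ^ (2 * k + 2) % 28 ≡ 1
  p^[2k+2]%28≡1 k = begin
    p ^ (2 * k + 2) % 28  ≡⟨ cong (λ e → p ^ e % 28) (2k+2≡2[k+1] k) ⟩
    p ^ (2 * suc k) % 28  ≡⟨ cong (_% 28) (^-double p (suc k)) ⟩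
    (p * p) ^ suc k % 28  ≡⟨ m%d≡1⇒m^n%d≡1 {p * p} {28} p²%28≡1 (suc k) ⟩
    1                     ∎
    where
    open ≡-Reasoning
    2k+2≡2[k+1] : ∀ k → 2 * k + 2 ≡ 2 * suc k
    2k+2≡2[k+1] = solve-∀
    p²%28≡1 : (p * p) % 28 ≡ 1
    p²%28≡1 = trans (%-distribˡ-* p p 28) ([ cong (λ x → (x * x) % 28) , cong (λ x → (x * x) % 28) ]′ p%28)

module _ (p k n W : ℕ) (p^[2k+2]≡ : p ^ (2 * k + 2) ≡ 1 + W * 28) where

  private
    X = p ^ (2 * k + 1)

  index≡8M+5 : 8 * X * n + (26 * p ^ (2 * k + 2) + 9) / 7 ≡ 8 * (X * n + 13 * W) + 5
  index≡8M+5 = begin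
    8 * X * n + (26 * p ^ (2 * k + 2) + 9) / 7  ≡⟨ cong (λ x → 8 * X * n + (26 * x + 9) / 7) p^[2k+2]≡ ⟩
    8 * X * n + (26 * (1 + W * 28) + 9) / 7     ≡⟨ cong (λ x → 8 * X * n + x / 7) (by-7 W) ⟩
    8 * X * n + (5 + 104 * W) * 7 / 7           ≡⟨ cong (_+_ (8 * X * n)) (m*n/n≡m (5 + 104 * W) 7) ⟩
    8 * X * n + (5 + 104 * W)                   ≡⟨ regroup X n W ⟩
    8 * (X * n + 13 * W) + 5                    ∎
    where
    open ≡-Reasoning
    by-7 : ∀ W → 26 * (1 + W * 28) + 9 ≡ (5 + 104 * W) * 7
    by-7 = solve-∀
    regroup : ∀ X n W → 8 * X * n + (5 + 104 * W) ≡ 8 * (X * n + 13 * W) + 5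
    regroup = solve-∀

  28M+13≡p^[2k+1]*[28n+13p] : 28 * (X * n + 13 * W) + 13 ≡ X * (28 * n + 13 * p)
  28M+13≡p^[2k+1]*[28n+13p] = begin
    28 * (X * n + 13 * W) + 13          ≡⟨ regroup X n W ⟩
    28 * X * n + 13 * (1 + W * 28)      ≡⟨ cong (λ x → 28 * X * n + 13 * x) p^[2k+2]≡ ⟨
    28 * X * n + 13 * p ^ (2 * k + 2)   ≡⟨ cong (λ e → 28 * X * n + 13 * p ^ e) (2k+2≡1+[2k+1] k) ⟩
    28 * X * n + 13 * (p * X)           ≡⟨ factor X n p ⟩
    X * (28 * n + 13 * p)               ∎
    where
    open ≡-Reasoning
    regroup : ∀ X n W → 28 * (X * n + 13 * W) + 13 ≡ 28 * X * n + 13 * (1 + W * 28)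
    regroup = solve-∀
    2k+2≡1+[2k+1] : ∀ k → 2 * k + 2 ≡ suc (2 * k + 1)
    2k+2≡1+[2k+1] = solve-∀
    factor : ∀ X n p → 28 * X * n + 13 * (p * X) ≡ X * (28 * n + 13 * p)
    factor = solve-∀

theorem4p3 : (p : ℕ) → Prime p → (p % 28 ≡ 15 ⊎ p % 28 ≡ 27) →
    (n k : ℕ) → ¬ (p ∣ n) →
    (+ 2) ℤ∣.∣ c 13 1 (8 * p ^ (2 * k + 1) * n + (26 * p ^ (2 * k + 2) + 9) / 7)
theorem4p3 p pr p%28 n k p∤n = parity-false⇒2∣ {c 13 1 N} (begin
  c₂ N            ≡⟨ cong c₂ (index≡8M+5 p k n W p^[2k+2]≡) ⟩
  c₂ (8 * M + 5)  ≡⟨ ⊛-inverse-section Ψ₂ c₂ twoSquares Ψ₂⊛c₂≗𝟙 Ψ₂⁷-section M ⟩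
  twoSquares M    ≡⟨ twoSquares-vanishes {M = M} pr (p%4≡3 {p} p%28) p∤28n+13p k 28M+13≡ ⟩
  false           ∎)
  where
  open ≡-Reasoning
  N = 8 * p ^ (2 * k + 1) * n + (26 * p ^ (2 * k + 2) + 9) / 7
  W = p ^ (2 * k + 2) / 28
  M = p ^ (2 * k + 1) * n + 13 * W
  p^[2k+2]≡ = trans (m≡m%n+[m/n]*n (p ^ (2 * k + 2)) 28) (cong (_+ W * 28) (p^[2k+2]%28≡1 {p} p%28 k))
  28M+13≡ = 28M+13≡p^[2k+1]*[28n+13p] p k n W p^[2k+2]≡
  p∤28n+13p = prime∤a*n+b*p 28 13 pr (p∤28 {p} p%28) p∤n
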